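{- Let $A\geq a\geq 1$ and $r\geq 2$ be integers. Then \[ \sum_{\pi\in\overline{\mathcal{P}}}z^{\widetilde{mes}_{r,A,a}(\pi)} q^{|\pi|} =\frac{(-q;q)_{\infty }}{(q;q)_{\infty}}\sum_{k=0}^{\infty }z^{kA+a}\bigg[\frac{q^{A\binom{k}{2}+ka}}{(-q^{a};q^{A})_{k}}(-q^{(r-2)a};q^{(r-2)A})_{k}-\frac{q^{A\binom{k+1}{2}+(k+1)a}}{(-q^{a};q^{A})_{k+1}}(-q^{(r-2)a};q^{(r-2)A})_{k+1}\bigg]. \]
   Context: An overpartition is a partition (finite non-increasing sequence of positive integers) in which the first occurrence of each part value may be overlined; $\overline{\mathcal{P}}$ is the set of all overpartitions and $|\pi|$ the sum of parts. $(a;q)_\infty=\prod_{i\geq0}(1-aq^i)$, $(a;q)_n=\prod_{i=0}^{n-1}(1-aq^i)$ (so when $r=2$, $(-q^{0};q^{0})_k=2^k$); $|q|<1$, $z$ a formal variable. For $r\geq2$, $\widetilde{mes}_{r,A,a}(\pi)$ is the smallest positive integer $m\equiv a\pmod A$ such that $\pi$ has no overlined part $\overline{m}$ and $\pi$ has fewer than $r-1$ non-overlined parts equal to $m$. -}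

module Defs where

open import Data.Nat using (ℕ; zero; suc; _+_; _*_; _∸_; _≡ᵇ_; _<ᵇ_)
open import Data.Nat.Combinatorics using (_C_)
open import Data.Integer as ℤ using (ℤ; +_; -_)
open import Data.Bool using (Bool; true; false; _∧_; not; if_then_else_)
open import Data.List using (List; []; _∷_; length)
open import Data.Product using (_×_; _,_; Σ)
open import Data.Bool using (T)

-- A part is a pair (value , overlined?).

Part : Set
Part = ℕ × Bool

positiveParts : List Part → Bool
positiveParts []            = true
positiveParts ((v , _) ∷ l) = (0 <ᵇ v) ∧ positiveParts l

stepOK : Part → Part → Bool
stepOK (v₁ , _) (v₂ , b₂) =
  (v₂ <ᵇ v₁) ∨' ((v₂ ≡ᵇ v₁) ∧ not b₂)
  where
  _∨'_ : Bool → Bool → Bool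
  true  ∨' _ = true
  false ∨' y = y

sortedOK : List Part → Bool
sortedOK []                = true
sortedOK (_ ∷ [])          = true
sortedOK (p ∷ (p' ∷ l))    = stepOK p p' ∧ sortedOK (p' ∷ l)

isOverpartition : List Part → Bool
isOverpartition π = positiveParts π ∧ sortedOK π

size : List Part → ℕ
size []            = 0
size ((v , _) ∷ l) = v + size l

hasOverlined : ℕ → List Part → Bool
hasOverlined m []                = false
hasOverlined m ((v , true) ∷ l)  = (v ≡ᵇ m) ∨'' hasOverlined m l
  where
  _∨''_ : Bool → Bool → Bool
  true  ∨'' _ = true
  false ∨'' y = y
hasOverlined m ((v , false) ∷ l) = hasOverlined m l

countPlain : ℕ → List Part → ℕ
countPlain m []                = 0
countPlain m ((v , true) ∷ l)  = countPlain m l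
countPlain m ((v , false) ∷ l) = (if v ≡ᵇ m then 1 else 0) + countPlain m l

free : ℕ → ℕ → List Part → Bool
free r m π = not (hasOverlined m π) ∧ (countPlain m π <ᵇ (r ∸ 1))

-- mes~_{r,A,a}(π): the positive integers ≡ a (mod A) are a, a+A, a+2A, …
-- (given 1 ≤ a ≤ A); search them in increasing order.  At most length π
-- candidates can be non-free (each non-free candidate needs a part equal
-- to it, since r-1 ≥ 1), so length π + 1 steps always suffice; the
-- fallback value 0 is never reached under the hypotheses.
mesSearch : ℕ → ℕ → ℕ → List Part → ℕ → ℕ → ℕ
mesSearch r A a π zero      j = 0
mesSearch r A a π (suc f) j =
  if free r (a + j * A) π then a + j * A else mesSearch r A a π f (suc j)

mes : ℕ → ℕ → ℕ → List Part → ℕ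
mes r A a π = mesSearch r A a π (suc (length π)) 0

OverpartitionsWith : ℕ → ℕ → ℕ → ℕ → ℕ → Set
OverpartitionsWith r A a n m =
  Σ (List Part) λ π →
    T (isOverpartition π ∧ ((size π ≡ᵇ n) ∧ (mes r A a π ≡ᵇ m)))

Series : Set
Series = ℕ → ℤ

sumTo : ℕ → (ℕ → ℤ) → ℤ
sumTo zero    h = h 0
sumTo (suc n) h = sumTo n h ℤ.+ h (suc n)

oneS : Series
oneS zero    = + 1
oneS (suc _) = + 0

monomial : ℕ → Series
monomial e n = if n ≡ᵇ e then + 1 else + 0

_⊕_ : Series → Series → Series
(f ⊕ g) n = f n ℤ.+ g n

_⊖_ : Series → Series → Series
(f ⊖ g) n = f n ℤ.- g n

_⊛_ : Series → Series → Series
(f ⊛ g) n = sumTo n (λ i → f i ℤ.* g (n ∸ i))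

prodS : ℕ → (ℕ → Series) → Series
prodS zero    f = oneS
prodS (suc k) f = prodS k f ⊛ f k

-- 1 + q^e   (equals the constant 2 when e = 0)
onePlus : ℕ → Series
onePlus e = oneS ⊕ monomial e

-- 1/(1 + q^e) = Σ_j (-1)^j q^{je}, for e ≥ 1
invOnePlus : ℕ → Series
invOnePlus e n = sumTo n (λ j → if (j * e) ≡ᵇ n then sign j else + 0)
  where
  sign : ℕ → ℤ
  sign zero          = + 1
  sign (suc zero)    = - (+ 1)
  sign (suc (suc j)) = sign j

-- 1/(1 - q^e) = Σ_j q^{je}, for e ≥ 1
invOneMinus : ℕ → Series
invOneMinus e n = sumTo n (λ j → if (j * e) ≡ᵇ n then + 1 else + 0)

-- (-q;q)_∞/(q;q)_∞ = ∏_{i≥1} (1+q^i)/(1-q^i); the coefficient of q^n only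
-- depends on the factors with i ≤ n.
overpartGF : Series
overpartGF n = prodS n (λ i → onePlus (suc i) ⊛ invOneMinus (suc i)) n

invPoch : ℕ → ℕ → ℕ → Series
invPoch A a k = prodS k (λ i → invOnePlus (a + i * A))

poch2 : ℕ → ℕ → ℕ → ℕ → Series
poch2 r A a k = prodS k (λ i → onePlus ((r ∸ 2) * a + i * ((r ∸ 2) * A)))

term : ℕ → ℕ → ℕ → ℕ → Series
term r A a k =
  monomial (A * (k C 2) + k * a) ⊛ (invPoch A a k ⊛ poch2 r A a k)

summand : ℕ → ℕ → ℕ → ℕ → Series
summand r A a k = overpartGF ⊛ (term r A a k ⊖ term r A a (suc k))

-- coefficient of z^m q^n in  Σ_{k≥0} z^{kA+a} · summand k
-- (only k ≤ m can have kA + a = m, since A ≥ 1)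
rhsCoeff : ℕ → ℕ → ℕ → ℕ → ℕ → ℤ
rhsCoeff r A a m n =
  sumTo m (λ k → if (k * A + a) ≡ᵇ m then summand r A a k n else + 0)

module Submission where

-- Let v_k = a + kA be the k-th candidate value of mes~.  An overpartition has mes~ = v_k exactly when
-- v_0, …, v_{k-1} are not free and v_k is free, so the overpartitions of n with mes~ = v_k number
-- N_k(n) - N_{k+1}(n), where N_k(n) counts those in which v_0, …, v_{k-1} are not free.  Grouping equal
-- parts, an overpartition chooses for every value v how often it occurs and whether its first copy is
-- overlined.  These choices contribute the factor (1 + q^v)/(1 - q^v), and the choices in which v is not
-- free contribute q^v (1 + q^{(r-2)v})/(1 - q^v), which is the former factor times
-- q^v (1 + q^{(r-2)v})/(1 + q^v).  Multiplying these ratios over v_0, …, v_{k-1} gives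
--   Σ_n N_k(n) q^n = (-q;q)_∞/(q;q)_∞ · q^{A·C(k,2)+ka} (-q^{(r-2)a};q^{(r-2)A})_k / (-q^a;q^A)_k,
-- and the theorem is the difference of the cases k and k + 1.

open import Defs
open import Data.Nat using (ℕ; _≤_)
open import Data.Integer using (+_)
open import Data.Fin using (Fin)
open import Data.Product using (∃-syntax; _×_)
open import Relation.Binary.PropositionalEquality using (_≡_)
open import Function.Bundles using (_↔_)

open import Data.Nat as ℕ using (zero; suc; _∸_; _<_; z≤n; s≤s; _≡ᵇ_; _≤ᵇ_; _<ᵇ_)
import Data.Nat.Properties as ℕP
open import Data.Nat.Divisibility using (_∣?_; divides)
open import Data.Nat.Combinatorics using (_C_; nCk+nC[k+1]≡[n+1]C[k+1]; nC1≡n)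
import Data.Nat.Tactic.RingSolver as ℕSolver
open import Data.Integer as ℤ using (ℤ; -_)
import Data.Integer.Properties as ℤP
import Data.Integer.Tactic.RingSolver as ℤSolver
open import Data.Bool using (Bool; true; false; if_then_else_; T; _∧_; _∨_; not)
import Data.Bool.Properties as BoolP
open import Data.Unit using (tt)
open import Data.Empty using (⊥-elim)
open import Data.Product using (Σ; _,_; proj₁; proj₂)
open import Data.Sum using (_⊎_; inj₁; inj₂)
open import Data.List using (List; []; _∷_; _++_; map; concatMap; replicate; length; lookup; span; filterᵇ)
import Data.List.Properties as ListP
import Data.Fin as Fin
import Data.Fin.Properties as FinP
open import Data.List.Relation.Unary.All as All using (All; []; _∷_)
import Data.List.Relation.Unary.All.Properties as AllP
open import Data.List.Relation.Unary.Any using (Any; here; there; index)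
open import Data.List.Relation.Unary.Any.Properties using (lookup-index)
open import Data.List.Relation.Unary.AllPairs using ([]; _∷_)
open import Data.List.Relation.Unary.Unique.Propositional using (Unique)
import Data.List.Relation.Unary.Unique.Propositional.Properties as UniqueP
open import Data.List.Membership.Propositional using (_∈_; find; lose)
import Data.List.Membership.Propositional.Properties as ∈P
open import Function.Base using (_∘_)
open import Function.Bundles using (mk↔ₛ′; Equivalence)
open import Relation.Binary.PropositionalEquality
  using (_≢_; refl; sym; trans; cong; cong₂; subst; _≗_; _→-setoid_; module ≡-Reasoning)
import Relation.Binary.Reasoning.Setoid (ℕ →-setoid ℤ) as ≗-Reasoning
open import Relation.Binary.Definitions using (tri<; tri≈; tri>)
open import Relation.Nullary using (¬_; yes; no)
open import Relation.Nullary.Decidable using (dec-true; dec-false)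

-- Formal power series

sumTo-cong : ∀ n {h g : ℕ → ℤ} → (∀ i → i ≤ n → h i ≡ g i) → sumTo n h ≡ sumTo n g
sumTo-cong zero    h≡g = h≡g 0 z≤n
sumTo-cong (suc n) h≡g =
  cong₂ ℤ._+_ (sumTo-cong n (λ i i≤n → h≡g i (ℕP.m≤n⇒m≤1+n i≤n))) (h≡g (suc n) ℕP.≤-refl)

sumTo-distrib-+ : ∀ n (h g : ℕ → ℤ) → sumTo n (λ i → h i ℤ.+ g i) ≡ sumTo n h ℤ.+ sumTo n g
sumTo-distrib-+ zero    h g = refl
sumTo-distrib-+ (suc n) h g rewrite sumTo-distrib-+ n h g =
  interchange (sumTo n h) (sumTo n g) (h (suc n)) (g (suc n))
  where
  interchange : ∀ x y z w → (x ℤ.+ y) ℤ.+ (z ℤ.+ w) ≡ (x ℤ.+ z) ℤ.+ (y ℤ.+ w)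
  interchange = ℤSolver.solve-∀

sumTo-distrib-- : ∀ n (h g : ℕ → ℤ) → sumTo n (λ i → h i ℤ.- g i) ≡ sumTo n h ℤ.- sumTo n g
sumTo-distrib-- zero    h g = refl
sumTo-distrib-- (suc n) h g rewrite sumTo-distrib-- n h g =
  interchange (sumTo n h) (sumTo n g) (h (suc n)) (g (suc n))
  where
  interchange : ∀ x y z w → (x ℤ.- y) ℤ.+ (z ℤ.- w) ≡ (x ℤ.+ z) ℤ.- (y ℤ.+ w)
  interchange = ℤSolver.solve-∀

*-distribˡ-sumTo : ∀ n c (h : ℕ → ℤ) → c ℤ.* sumTo n h ≡ sumTo n (λ i → c ℤ.* h i)
*-distribˡ-sumTo zero    c h = refl
*-distribˡ-sumTo (suc n) c h =
  trans (ℤP.*-distribˡ-+ c (sumTo n h) (h (suc n))) (cong (ℤ._+ c ℤ.* h (suc n)) (*-distribˡ-sumTo n c h))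

*-distribʳ-sumTo : ∀ n c (h : ℕ → ℤ) → sumTo n h ℤ.* c ≡ sumTo n (λ i → h i ℤ.* c)
*-distribʳ-sumTo zero    c h = refl
*-distribʳ-sumTo (suc n) c h =
  trans (ℤP.*-distribʳ-+ c (sumTo n h) (h (suc n))) (cong (ℤ._+ h (suc n) ℤ.* c) (*-distribʳ-sumTo n c h))

sumTo-zero : ∀ n {h : ℕ → ℤ} → (∀ i → i ≤ n → h i ≡ + 0) → sumTo n h ≡ + 0
sumTo-zero zero    h≡0 = h≡0 0 z≤n
sumTo-zero (suc n) h≡0 =
  cong₂ ℤ._+_ (sumTo-zero n (λ i i≤n → h≡0 i (ℕP.m≤n⇒m≤1+n i≤n))) (h≡0 (suc n) ℕP.≤-refl)

sumTo-single : ∀ n j {h : ℕ → ℤ} → j ≤ n → (∀ i → i ≤ n → i ≢ j → h i ≡ + 0) → sumTo n h ≡ h j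
sumTo-single zero    .zero z≤n _   = refl
sumTo-single (suc n) j {h} j≤1+n off with j ℕP.≟ suc n
... | yes refl = trans (cong (ℤ._+ h (suc n)) (sumTo-zero n λ i i≤n →
                               off i (ℕP.m≤n⇒m≤1+n i≤n) (ℕP.<⇒≢ (s≤s i≤n))))
                       (ℤP.+-identityˡ _)
... | no j≢1+n = trans (cong₂ ℤ._+_ (sumTo-single n j (ℕP.≤-pred (ℕP.≤∧≢⇒< j≤1+n j≢1+n))
                                      (λ i i≤n → off i (ℕP.m≤n⇒m≤1+n i≤n)))
                                    (off (suc n) ℕP.≤-refl (j≢1+n ∘ sym)))
                       (ℤP.+-identityʳ _)

sumTo-shift : ∀ n (h : ℕ → ℤ) → sumTo (suc n) h ≡ h 0 ℤ.+ sumTo n (h ∘ suc)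
sumTo-shift zero    h = refl
sumTo-shift (suc n) h = trans (cong (ℤ._+ h (suc (suc n))) (sumTo-shift n h)) (ℤP.+-assoc (h 0) _ _)

sumTo-reverse : ∀ n (h : ℕ → ℤ) → sumTo n h ≡ sumTo n (λ i → h (n ∸ i))
sumTo-reverse zero    h = refl
sumTo-reverse (suc n) h = begin
  sumTo n h ℤ.+ h (suc n)                   ≡⟨ cong (ℤ._+ h (suc n)) (sumTo-reverse n h) ⟩
  sumTo n (λ i → h (n ∸ i)) ℤ.+ h (suc n)   ≡⟨ ℤP.+-comm _ (h (suc n)) ⟩
  h (suc n) ℤ.+ sumTo n (λ i → h (n ∸ i))   ≡⟨ sumTo-shift n (λ i → h (suc n ∸ i)) ⟨
  sumTo (suc n) (λ i → h (suc n ∸ i))       ∎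
  where open ≡-Reasoning

sumTo-triangle : ∀ n (F : ℕ → ℕ → ℤ) →
  sumTo n (λ i → sumTo i (F i)) ≡ sumTo n (λ j → sumTo (n ∸ j) (λ t → F (j ℕ.+ t) j))
sumTo-triangle zero    F = refl
sumTo-triangle (suc n) F = begin
  sumTo n (λ i → sumTo i (F i)) ℤ.+ sumTo (suc n) (F (suc n))
    ≡⟨ cong (ℤ._+ sumTo (suc n) (F (suc n))) (sumTo-triangle n F) ⟩
  R ℤ.+ (sumTo n (F (suc n)) ℤ.+ F (suc n) (suc n))
    ≡⟨ ℤP.+-assoc R _ _ ⟨
  (R ℤ.+ sumTo n (F (suc n))) ℤ.+ F (suc n) (suc n)
    ≡⟨ cong (ℤ._+ F (suc n) (suc n)) (sumTo-distrib-+ n _ _) ⟨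
  sumTo n (λ j → sumTo (n ∸ j) (λ t → F (j ℕ.+ t) j) ℤ.+ F (suc n) j) ℤ.+ F (suc n) (suc n)
    ≡⟨ cong₂ ℤ._+_ (sumTo-cong n grow) top ⟨
  sumTo n (λ j → sumTo (suc n ∸ j) (λ t → F (j ℕ.+ t) j)) ℤ.+ sumTo (n ∸ n) (λ t → F (suc n ℕ.+ t) (suc n))
    ∎
  where
  open ≡-Reasoning
  R : ℤ
  R = sumTo n (λ j → sumTo (n ∸ j) (λ t → F (j ℕ.+ t) j))
  top : sumTo (n ∸ n) (λ t → F (suc n ℕ.+ t) (suc n)) ≡ F (suc n) (suc n)
  top = trans (cong (λ x → sumTo x (λ t → F (suc n ℕ.+ t) (suc n))) (ℕP.n∸n≡0 n))
              (cong (λ x → F x (suc n)) (ℕP.+-identityʳ (suc n)))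
  grow : ∀ j → j ≤ n →
    sumTo (suc n ∸ j) (λ t → F (j ℕ.+ t) j) ≡ sumTo (n ∸ j) (λ t → F (j ℕ.+ t) j) ℤ.+ F (suc n) j
  grow j j≤n rewrite ℕP.+-∸-assoc 1 j≤n =
    cong (λ x → sumTo (n ∸ j) (λ t → F (j ℕ.+ t) j) ℤ.+ F x j)
      (trans (ℕP.+-suc j (n ∸ j)) (cong suc (ℕP.m+[n∸m]≡n j≤n)))

⊛-cong : ∀ {f f′ g g′} → f ≗ f′ → g ≗ g′ → (f ⊛ g) ≗ (f′ ⊛ g′)
⊛-cong f≗f′ g≗g′ n = sumTo-cong n (λ i _ → cong₂ ℤ._*_ (f≗f′ i) (g≗g′ (n ∸ i)))

⊛-congˡ : ∀ {f f′} g → f ≗ f′ → (f ⊛ g) ≗ (f′ ⊛ g)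
⊛-congˡ g f≗f′ = ⊛-cong {g = g} {g′ = g} f≗f′ (λ _ → refl)

⊛-congʳ : ∀ f {g g′} → g ≗ g′ → (f ⊛ g) ≗ (f ⊛ g′)
⊛-congʳ f g≗g′ = ⊛-cong {f = f} {f′ = f} (λ _ → refl) g≗g′

⊛-comm : ∀ f g → (f ⊛ g) ≗ (g ⊛ f)
⊛-comm f g n = trans (sumTo-reverse n _) (sumTo-cong n λ i i≤n →
  trans (cong (λ x → f (n ∸ i) ℤ.* g x) (ℕP.m∸[m∸n]≡n i≤n)) (ℤP.*-comm (f (n ∸ i)) (g i)))

⊛-assoc : ∀ f g h → ((f ⊛ g) ⊛ h) ≗ (f ⊛ (g ⊛ h))
⊛-assoc f g h n = begin
  sumTo n (λ i → sumTo i (λ j → f j ℤ.* g (i ∸ j)) ℤ.* h (n ∸ i))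
    ≡⟨ sumTo-cong n (λ i _ → *-distribʳ-sumTo i (h (n ∸ i)) (λ j → f j ℤ.* g (i ∸ j))) ⟩
  sumTo n (λ i → sumTo i (λ j → (f j ℤ.* g (i ∸ j)) ℤ.* h (n ∸ i)))
    ≡⟨ sumTo-triangle n (λ i j → (f j ℤ.* g (i ∸ j)) ℤ.* h (n ∸ i)) ⟩
  sumTo n (λ j → sumTo (n ∸ j) (λ t → (f j ℤ.* g ((j ℕ.+ t) ∸ j)) ℤ.* h (n ∸ (j ℕ.+ t))))
    ≡⟨ sumTo-cong n (λ j _ → sumTo-cong (n ∸ j) λ t _ →
         trans (ℤP.*-assoc (f j) _ _)
               (cong₂ (λ x y → f j ℤ.* (g x ℤ.* h y)) (ℕP.m+n∸m≡n j t) (sym (ℕP.∸-+-assoc n j t)))) ⟩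
  sumTo n (λ j → sumTo (n ∸ j) (λ t → f j ℤ.* (g t ℤ.* h (n ∸ j ∸ t))))
    ≡⟨ sumTo-cong n (λ j _ → *-distribˡ-sumTo (n ∸ j) (f j) _) ⟨
  sumTo n (λ j → f j ℤ.* sumTo (n ∸ j) (λ t → g t ℤ.* h (n ∸ j ∸ t)))
    ∎
  where open ≡-Reasoning

⊛-identityˡ : ∀ f → (oneS ⊛ f) ≗ f
⊛-identityˡ f n = trans (sumTo-single n 0 z≤n off) (ℤP.*-identityˡ (f n))
  where
  off : ∀ i → i ≤ n → i ≢ 0 → oneS i ℤ.* f (n ∸ i) ≡ + 0
  off zero    _ 0≢0 = ⊥-elim (0≢0 refl)
  off (suc i) _ _   = ℤP.*-zeroˡ (f (n ∸ suc i))

⊛-identityʳ : ∀ f → (f ⊛ oneS) ≗ f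
⊛-identityʳ f n = trans (⊛-comm f oneS n) (⊛-identityˡ f n)

⊛-distribʳ-⊕ : ∀ f g h → ((g ⊕ h) ⊛ f) ≗ ((g ⊛ f) ⊕ (h ⊛ f))
⊛-distribʳ-⊕ f g h n =
  trans (sumTo-cong n (λ i _ → ℤP.*-distribʳ-+ (f (n ∸ i)) (g i) (h i))) (sumTo-distrib-+ n _ _)

⊛-distribˡ-⊖ : ∀ f g h → (f ⊛ (g ⊖ h)) ≗ ((f ⊛ g) ⊖ (f ⊛ h))
⊛-distribˡ-⊖ f g h n =
  trans (sumTo-cong n (λ i _ → distrib (f i) (g (n ∸ i)) (h (n ∸ i)))) (sumTo-distrib-- n _ _)
  where
  distrib : ∀ x y z → x ℤ.* (y ℤ.- z) ≡ x ℤ.* y ℤ.- x ℤ.* z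
  distrib = ℤSolver.solve-∀

⊛-interchange : ∀ f g h k → ((f ⊛ g) ⊛ (h ⊛ k)) ≗ ((f ⊛ h) ⊛ (g ⊛ k))
⊛-interchange f g h k = begin
  (f ⊛ g) ⊛ (h ⊛ k)   ≈⟨ ⊛-assoc f g (h ⊛ k) ⟩
  f ⊛ (g ⊛ (h ⊛ k))   ≈⟨ ⊛-congʳ f (⊛-assoc g h k) ⟨
  f ⊛ ((g ⊛ h) ⊛ k)   ≈⟨ ⊛-congʳ f (⊛-congˡ k (⊛-comm g h)) ⟩
  f ⊛ ((h ⊛ g) ⊛ k)   ≈⟨ ⊛-congʳ f (⊛-assoc h g k) ⟩
  f ⊛ (h ⊛ (g ⊛ k))   ≈⟨ ⊛-assoc f h (g ⊛ k) ⟨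
  (f ⊛ h) ⊛ (g ⊛ k)   ∎
  where open ≗-Reasoning

prodS-cong : ∀ N {f g : ℕ → Series} → (∀ i → i < N → f i ≗ g i) → prodS N f ≗ prodS N g
prodS-cong zero    f≗g = λ _ → refl
prodS-cong (suc N) f≗g =
  ⊛-cong (prodS-cong N (λ i i<N → f≗g i (ℕP.m≤n⇒m≤1+n i<N))) (f≗g N ℕP.≤-refl)

monomial-on : ∀ e → monomial e e ≡ + 1
monomial-on e rewrite dec-true (e ℕP.≟ e) refl = refl

monomial-off : ∀ {e i} → i ≢ e → monomial e i ≡ + 0
monomial-off {e} {i} i≢e rewrite dec-false (i ℕP.≟ e) i≢e = refl

monomial-⊛-≥ : ∀ e f n → e ≤ n → (monomial e ⊛ f) n ≡ f (n ∸ e)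
monomial-⊛-≥ e f n e≤n = begin
  (monomial e ⊛ f) n           ≡⟨ sumTo-single n e e≤n (λ i _ i≢e →
                                    trans (cong (ℤ._* f (n ∸ i)) (monomial-off i≢e)) (ℤP.*-zeroˡ (f (n ∸ i)))) ⟩
  monomial e e ℤ.* f (n ∸ e)   ≡⟨ cong (ℤ._* f (n ∸ e)) (monomial-on e) ⟩
  + 1 ℤ.* f (n ∸ e)            ≡⟨ ℤP.*-identityˡ _ ⟩
  f (n ∸ e)                    ∎
  where open ≡-Reasoning

monomial-⊛-< : ∀ e f n → n < e → (monomial e ⊛ f) n ≡ + 0
monomial-⊛-< e f n n<e = sumTo-zero n λ i i≤n →
  trans (cong (ℤ._* f (n ∸ i)) (monomial-off (ℕP.<⇒≢ (ℕP.≤-<-trans i≤n n<e)))) (ℤP.*-zeroˡ (f (n ∸ i)))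

monomial-+ : ∀ e₁ e₂ → (monomial e₁ ⊛ monomial e₂) ≗ monomial (e₁ ℕ.+ e₂)
monomial-+ e₁ e₂ n with e₁ ℕP.≤? n
... | no e₁≰n = trans (monomial-⊛-< e₁ (monomial e₂) n (ℕP.≰⇒> e₁≰n))
                      (sym (monomial-off {e₁ ℕ.+ e₂} {n} λ { refl → e₁≰n (ℕP.m≤m+n e₁ e₂) }))
... | yes e₁≤n =
  trans (monomial-⊛-≥ e₁ (monomial e₂) n e₁≤n) (shifted (n ∸ e₁) (ℕP.m+[n∸m]≡n e₁≤n))
  where
  shifted : ∀ d → e₁ ℕ.+ d ≡ n → monomial e₂ d ≡ monomial (e₁ ℕ.+ e₂) n
  shifted d refl with d ℕP.≟ e₂
  ... | yes refl = trans (monomial-on e₂) (sym (monomial-on (e₁ ℕ.+ e₂)))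
  ... | no d≢e₂  = trans (monomial-off d≢e₂) (sym (monomial-off (d≢e₂ ∘ ℕP.+-cancelˡ-≡ e₁ d e₂)))

onePlus-⊛ : ∀ e f → (onePlus e ⊛ f) ≗ (f ⊕ (monomial e ⊛ f))
onePlus-⊛ e f n =
  trans (⊛-distribʳ-⊕ f oneS (monomial e) n) (cong (ℤ._+ (monomial e ⊛ f) n) (⊛-identityˡ f n))

-- Series in the powers of a fixed q^v

inPowersOf : ℕ → (ℕ → ℤ) → Series
inPowersOf v W j = sumTo j (λ c → if c ℕ.* v ≡ᵇ j then W c else + 0)

delay : ℕ → (ℕ → ℤ) → ℕ → ℤ
delay t W c = if t ≤ᵇ c then W (c ∸ t) else + 0

inPowersOf-cong : ∀ v {W W′} → (∀ c → W c ≡ W′ c) → inPowersOf v W ≗ inPowersOf v W′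
inPowersOf-cong v W≡W′ j = sumTo-cong j (λ c _ → cong (if c ℕ.* v ≡ᵇ j then_else + 0) (W≡W′ c))

module _ (v : ℕ) .{{_ : ℕ.NonZero v}} where

  NotMultiple : ℕ → Set
  NotMultiple j = ∀ c → c ℕ.* v ≢ j

  multiple? : ∀ j → (Σ ℕ λ c → c ℕ.* v ≡ j) ⊎ NotMultiple j
  multiple? j with v ∣? j
  ... | yes (divides c j≡cv) = inj₁ (c , sym j≡cv)
  ... | no v∤j               = inj₂ (λ c cv≡j → v∤j (divides c (sym cv≡j)))

  inPowersOf-multiple : ∀ W c → inPowersOf v W (c ℕ.* v) ≡ W c
  inPowersOf-multiple W c = trans
    (sumTo-single (c ℕ.* v) c (ℕP.m≤m*n c v) λ i _ i≢c →
      cong (if_then W i else + 0) (dec-false (i ℕ.* v ℕP.≟ c ℕ.* v) (i≢c ∘ ℕP.*-cancelʳ-≡ i c v)))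
    (cong (if_then W c else + 0) (dec-true (c ℕ.* v ℕP.≟ c ℕ.* v) refl))

  inPowersOf-notMultiple : ∀ W j → NotMultiple j → inPowersOf v W j ≡ + 0
  inPowersOf-notMultiple W j ¬cv≡j =
    sumTo-zero j (λ c _ → cong (if_then W c else + 0) (dec-false (c ℕ.* v ℕP.≟ j) (¬cv≡j c)))

  inPowersOf-unique : ∀ W f → (∀ c → f (c ℕ.* v) ≡ W c) → (∀ j → NotMultiple j → f j ≡ + 0) →
                      f ≗ inPowersOf v W
  inPowersOf-unique W f onMultiples offMultiples j with multiple? j
  ... | inj₁ (c , refl) = trans (onMultiples c) (sym (inPowersOf-multiple W c))
  ... | inj₂ ¬cv≡j      = trans (offMultiples j ¬cv≡j) (sym (inPowersOf-notMultiple W j ¬cv≡j))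

  inPowersOf-⊕ : ∀ W W′ → (inPowersOf v W ⊕ inPowersOf v W′) ≗ inPowersOf v (λ c → W c ℤ.+ W′ c)
  inPowersOf-⊕ W W′ = inPowersOf-unique _ _
    (λ c → cong₂ ℤ._+_ (inPowersOf-multiple W c) (inPowersOf-multiple W′ c))
    (λ j ¬cv≡j → cong₂ ℤ._+_ (inPowersOf-notMultiple W j ¬cv≡j) (inPowersOf-notMultiple W′ j ¬cv≡j))

  monomial-⊛-inPowersOf : ∀ t W → (monomial (t ℕ.* v) ⊛ inPowersOf v W) ≗ inPowersOf v (delay t W)
  monomial-⊛-inPowersOf t W = inPowersOf-unique _ _ onMultiples offMultiples
    where
    G : Series
    G = inPowersOf v W
    onMultiples : ∀ c → (monomial (t ℕ.* v) ⊛ G) (c ℕ.* v) ≡ delay t W c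
    onMultiples c with t ℕP.≤? c
    ... | yes t≤c = begin
      (monomial (t ℕ.* v) ⊛ G) (c ℕ.* v)
        ≡⟨ monomial-⊛-≥ (t ℕ.* v) G (c ℕ.* v) (ℕP.*-monoˡ-≤ v t≤c) ⟩
      G (c ℕ.* v ∸ t ℕ.* v)
        ≡⟨ cong G (ℕP.*-distribʳ-∸ v c t) ⟨
      G ((c ∸ t) ℕ.* v)
        ≡⟨ inPowersOf-multiple W (c ∸ t) ⟩
      W (c ∸ t)
        ≡⟨ cong (if_then W (c ∸ t) else + 0) (dec-true (t ℕP.≤? c) t≤c) ⟨
      delay t W c
        ∎
      where open ≡-Reasoning
    ... | no t≰c = trans (monomial-⊛-< (t ℕ.* v) G (c ℕ.* v) (ℕP.≰⇒> (t≰c ∘ ℕP.*-cancelʳ-≤ t c v)))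
                         (cong (if_then W (c ∸ t) else + 0) (sym (dec-false (t ℕP.≤? c) t≰c)))
    offMultiples : ∀ j → NotMultiple j → (monomial (t ℕ.* v) ⊛ G) j ≡ + 0
    offMultiples j ¬cv≡j with t ℕ.* v ℕP.≤? j
    ... | no tv≰j  = monomial-⊛-< (t ℕ.* v) G j (ℕP.≰⇒> tv≰j)
    ... | yes tv≤j = trans (monomial-⊛-≥ (t ℕ.* v) G j tv≤j) (inPowersOf-notMultiple W (j ∸ t ℕ.* v) λ c cv≡j-tv →
        ¬cv≡j (c ℕ.+ t) (trans (ℕP.*-distribʳ-+ v c t)
                               (trans (cong (ℕ._+ t ℕ.* v) cv≡j-tv) (ℕP.m∸n+n≡m tv≤j))))

  onePlus-⊛-inPowersOf : ∀ t W →
    (onePlus (t ℕ.* v) ⊛ inPowersOf v W) ≗ inPowersOf v (λ c → W c ℤ.+ delay t W c)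
  onePlus-⊛-inPowersOf t W = begin
    onePlus (t ℕ.* v) ⊛ inPowersOf v W
      ≈⟨ onePlus-⊛ (t ℕ.* v) (inPowersOf v W) ⟩
    inPowersOf v W ⊕ (monomial (t ℕ.* v) ⊛ inPowersOf v W)
      ≈⟨ (λ n → cong (ℤ._+_ (inPowersOf v W n)) (monomial-⊛-inPowersOf t W n)) ⟩
    inPowersOf v W ⊕ inPowersOf v (delay t W)
      ≈⟨ inPowersOf-⊕ W (delay t W) ⟩
    inPowersOf v (λ c → W c ℤ.+ delay t W c)
      ∎
    where open ≗-Reasoning

  inPowersOf-oneS : inPowersOf v oneS ≗ oneS
  inPowersOf-oneS zero    = refl
  inPowersOf-oneS (suc n) = sumTo-zero (suc n) λ
    { zero    _ → refl
    ; (suc c) _ → BoolP.if-eta (suc c ℕ.* v ≡ᵇ suc n) }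

alternating : ℕ → ℤ
alternating zero    = + 1
alternating (suc c) = - alternating c

-- The sign function of invOnePlus is local to its definition, so it is identified through its equations.
invOnePlus≗inPowersOf : ∀ e → invOnePlus e ≗ inPowersOf e alternating
invOnePlus≗inPowersOf e n =
  let sign≡alternating = alternating-unique _ refl refl (λ _ → refl)
  in sumTo-cong n (λ j _ → cong (if j ℕ.* e ≡ᵇ n then_else + 0) (sign≡alternating j))
  where
  alternating-unique : (σ : ℕ → ℤ) → σ 0 ≡ + 1 → σ 1 ≡ - + 1 → (∀ j → σ (2 ℕ.+ j) ≡ σ j) →
                       ∀ j → σ j ≡ alternating j
  alternating-unique σ σ0 σ1 σ2 zero          = σ0
  alternating-unique σ σ0 σ1 σ2 (suc zero)    = σ1
  alternating-unique σ σ0 σ1 σ2 (suc (suc j)) =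
    trans (σ2 j) (trans (alternating-unique σ σ0 σ1 σ2 j) (sym (ℤP.neg-involutive (alternating j))))

onePlus-⊛-invOnePlus : ∀ v .{{_ : ℕ.NonZero v}} → (onePlus v ⊛ invOnePlus v) ≗ oneS
onePlus-⊛-invOnePlus v = begin
  onePlus v ⊛ invOnePlus v
    ≈⟨ ⊛-cong (λ n → cong (λ e → onePlus e n) (sym (ℕP.*-identityˡ v))) (invOnePlus≗inPowersOf v) ⟩
  onePlus (1 ℕ.* v) ⊛ inPowersOf v alternating
    ≈⟨ onePlus-⊛-inPowersOf v 1 alternating ⟩
  inPowersOf v (λ c → alternating c ℤ.+ delay 1 alternating c)
    ≈⟨ inPowersOf-cong v (λ { zero → refl ; (suc c) → ℤP.+-inverseˡ (alternating c) }) ⟩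
  inPowersOf v oneS
    ≈⟨ inPowersOf-oneS v ⟩
  oneS
    ∎
  where open ≗-Reasoning

-- Generating functions of overpartitions with non-free values

overpartFactor : ℕ → Series
overpartFactor v = onePlus v ⊛ invOneMinus v

nonfreeRatio : ℕ → ℕ → Series
nonfreeRatio v e = monomial v ⊛ (invOnePlus v ⊛ onePlus e)

nonfreeFactor : ℕ → ℕ → Series
nonfreeFactor v e = overpartFactor v ⊛ nonfreeRatio v e

-- The number of ways a value can occur c times (only its first copy may be overlined), and of those in
-- which it is not free when r = t + 2: the overlined way always, the plain one once c ≥ r - 1.
blockCount : ℕ → ℤ
blockCount c = + 1 ℤ.+ delay 1 (λ _ → + 1) c

nonfreeBlockCount : ℕ → ℕ → ℤ
nonfreeBlockCount t = delay 1 (λ c → + 1 ℤ.+ delay t (λ _ → + 1) c)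

module _ (v : ℕ) .{{_ : ℕ.NonZero v}} where

  overpartFactor-inPowersOf : overpartFactor v ≗ inPowersOf v blockCount
  overpartFactor-inPowersOf = begin
    onePlus v ⊛ invOneMinus v
      ≈⟨ ⊛-congˡ (invOneMinus v) (λ n → cong (λ e → onePlus e n) (sym (ℕP.*-identityˡ v))) ⟩
    onePlus (1 ℕ.* v) ⊛ inPowersOf v (λ _ → + 1)
      ≈⟨ onePlus-⊛-inPowersOf v 1 (λ _ → + 1) ⟩
    inPowersOf v blockCount
      ∎
    where open ≗-Reasoning

  nonfreeFactor-inPowersOf : ∀ t → nonfreeFactor v (t ℕ.* v) ≗ inPowersOf v (nonfreeBlockCount t)
  nonfreeFactor-inPowersOf t = begin
    (p ⊛ i₋) ⊛ (q ⊛ (i₊ ⊛ pₜ))   ≈⟨ ⊛-comm (p ⊛ i₋) (q ⊛ (i₊ ⊛ pₜ)) ⟩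
    (q ⊛ (i₊ ⊛ pₜ)) ⊛ (p ⊛ i₋)   ≈⟨ ⊛-assoc q (i₊ ⊛ pₜ) (p ⊛ i₋) ⟩
    q ⊛ ((i₊ ⊛ pₜ) ⊛ (p ⊛ i₋))   ≈⟨ ⊛-congʳ q (⊛-interchange i₊ pₜ p i₋) ⟩
    q ⊛ ((i₊ ⊛ p) ⊛ (pₜ ⊛ i₋))   ≈⟨ ⊛-congʳ q (⊛-congˡ (pₜ ⊛ i₋) λ n →
                                      trans (⊛-comm i₊ p n) (onePlus-⊛-invOnePlus v n)) ⟩
    q ⊛ (oneS ⊛ (pₜ ⊛ i₋))       ≈⟨ ⊛-congʳ q (⊛-identityˡ (pₜ ⊛ i₋)) ⟩
    q ⊛ (pₜ ⊛ i₋)                ≈⟨ ⊛-cong (λ n → cong (λ e → monomial e n) (sym (ℕP.*-identityˡ v)))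
                                           (onePlus-⊛-inPowersOf v t (λ _ → + 1)) ⟩
    monomial (1 ℕ.* v) ⊛ inPowersOf v (λ c → + 1 ℤ.+ delay t (λ _ → + 1) c)
                                 ≈⟨ monomial-⊛-inPowersOf v 1 (λ c → + 1 ℤ.+ delay t (λ _ → + 1) c) ⟩
    inPowersOf v (nonfreeBlockCount t) ∎
    where
    open ≗-Reasoning
    p i₋ q i₊ pₜ : Series
    p = onePlus v
    i₋ = invOneMinus v
    q = monomial v
    i₊ = invOnePlus v
    pₜ = onePlus (t ℕ.* v)

⊛-swapʳ : ∀ f g h → ((f ⊛ g) ⊛ h) ≗ ((f ⊛ h) ⊛ g)
⊛-swapʳ f g h = begin
  (f ⊛ g) ⊛ h   ≈⟨ ⊛-assoc f g h ⟩
  f ⊛ (g ⊛ h)   ≈⟨ ⊛-congʳ f (⊛-comm g h) ⟩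
  f ⊛ (h ⊛ g)   ≈⟨ ⊛-assoc f h g ⟨
  (f ⊛ h) ⊛ g   ∎
  where open ≗-Reasoning

factor : ℕ → Bool → ℕ → Series
factor t nonfree v = if nonfree then nonfreeFactor v (t ℕ.* v) else overpartFactor v

-- The generating function of overpartitions with parts ≤ N in which no value u with c u is free,
-- when r = t + 2.
restrictedGF : ℕ → (ℕ → Bool) → ℕ → Series
restrictedGF t c N = prodS N (λ i → factor t (c (suc i)) (suc i))

mark : ℕ → (ℕ → Bool) → ℕ → Bool
mark v c u = c u ∨ (v ≡ᵇ u)

mark-other : ∀ {v u} c → v ≢ u → mark v c u ≡ c u
mark-other {v} {u} c v≢u rewrite dec-false (v ℕP.≟ u) v≢u = BoolP.∨-identityʳ (c u)

restrictedGF-mark : ∀ t c v N → c v ≡ false → 1 ≤ v → v ≤ N →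
                    (restrictedGF t c N ⊛ nonfreeRatio v (t ℕ.* v)) ≗ restrictedGF t (mark v c) N
restrictedGF-mark t c v zero    _        1≤v v≤0 = ⊥-elim (ℕP.<-irrefl refl (ℕP.≤-trans 1≤v v≤0))
restrictedGF-mark t c v (suc N) cv≡false 1≤v v≤1+N with v ℕP.≟ suc N
... | yes refl = begin
  (restrictedGF t c N ⊛ factor t (c v) v) ⊛ X  ≈⟨ ⊛-assoc (restrictedGF t c N) (factor t (c v) v) X ⟩
  restrictedGF t c N ⊛ (factor t (c v) v ⊛ X)  ≈⟨ ⊛-cong (prodS-cong N unmarked) marked ⟩
  restrictedGF t (mark v c) (suc N)            ∎
  where
  open ≗-Reasoning
  X : Series
  X = nonfreeRatio v (t ℕ.* v)
  unmarked : ∀ i → i < N → factor t (c (suc i)) (suc i) ≗ factor t (mark v c (suc i)) (suc i)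
  unmarked i i<N n = cong (λ b → factor t b (suc i) n) (sym (mark-other c (ℕP.>⇒≢ (s≤s i<N))))
  marked : (factor t (c v) v ⊛ X) ≗ factor t (mark v c v) v
  marked rewrite cv≡false | dec-true (v ℕP.≟ v) refl = λ _ → refl
... | no v≢1+N = begin
  (restrictedGF t c N ⊛ factor t (c (suc N)) (suc N)) ⊛ X
    ≈⟨ ⊛-swapʳ (restrictedGF t c N) (factor t (c (suc N)) (suc N)) X ⟩
  (restrictedGF t c N ⊛ X) ⊛ factor t (c (suc N)) (suc N)
    ≈⟨ ⊛-cong (restrictedGF-mark t c v N cv≡false 1≤v (ℕP.≤-pred (ℕP.≤∧≢⇒< v≤1+N v≢1+N)))
              (λ n → cong (λ b → factor t b (suc N) n) (sym (mark-other c v≢1+N))) ⟩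
  restrictedGF t (mark v c) (suc N)
    ∎
  where
  open ≗-Reasoning
  X : Series
  X = nonfreeRatio v (t ℕ.* v)

overpartGFUpTo : ℕ → Series
overpartGFUpTo N = prodS N (λ i → overpartFactor (suc i))

⊛-coeff-unchanged : ∀ f g i → g 0 ≡ + 1 → (∀ j → 1 ≤ j → j ≤ i → g j ≡ + 0) → (f ⊛ g) i ≡ f i
⊛-coeff-unchanged f g i g0≡1 gj≡0 = begin
  (f ⊛ g) i            ≡⟨ sumTo-single i i ℕP.≤-refl (λ t t≤i t≢i →
                            trans (cong (f t ℤ.*_)
                                        (gj≡0 (i ∸ t) (ℕP.m<n⇒0<n∸m (ℕP.≤∧≢⇒< t≤i t≢i)) (ℕP.m∸n≤m i t)))
                                  (ℤP.*-zeroʳ (f t))) ⟩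
  f i ℤ.* g (i ∸ i)    ≡⟨ cong (λ x → f i ℤ.* g x) (ℕP.n∸n≡0 i) ⟩
  f i ℤ.* g 0          ≡⟨ cong (f i ℤ.*_) g0≡1 ⟩
  f i ℤ.* + 1          ≡⟨ ℤP.*-identityʳ (f i) ⟩
  f i                  ∎
  where open ≡-Reasoning

overpartFactor-below : ∀ v .{{_ : ℕ.NonZero v}} j → 1 ≤ j → j < v → overpartFactor v j ≡ + 0
overpartFactor-below v j 1≤j j<v =
  trans (overpartFactor-inPowersOf v j) (inPowersOf-notMultiple v blockCount j notMultiple)
  where
  notMultiple : NotMultiple v j
  notMultiple zero    refl = ℕP.<-irrefl refl 1≤j
  notMultiple (suc c) refl = ℕP.<-irrefl refl (ℕP.<-≤-trans j<v (ℕP.m≤m+n v (c ℕ.* v)))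

overpartGFUpTo-stable : ∀ N d i → i ≤ N → overpartGFUpTo (d ℕ.+ N) i ≡ overpartGFUpTo N i
overpartGFUpTo-stable N zero    i i≤N = refl
overpartGFUpTo-stable N (suc d) i i≤N = trans
  (⊛-coeff-unchanged (overpartGFUpTo (d ℕ.+ N)) (overpartFactor (suc (d ℕ.+ N))) i refl λ j 1≤j j≤i →
    overpartFactor-below (suc (d ℕ.+ N)) j 1≤j (s≤s (ℕP.≤-trans j≤i (ℕP.≤-trans i≤N (ℕP.m≤n+m N d)))))
  (overpartGFUpTo-stable N d i i≤N)

overpartGF-⊛-truncate : ∀ n N g → n ≤ N → (overpartGF ⊛ g) n ≡ (overpartGFUpTo N ⊛ g) n
overpartGF-⊛-truncate n N g n≤N = sumTo-cong n λ i i≤n → cong (ℤ._* g (n ∸ i)) (trans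
  (sym (overpartGFUpTo-stable i (N ∸ i) i ℕP.≤-refl))
  (cong (λ x → overpartGFUpTo x i) (ℕP.m∸n+n≡m (ℕP.≤-trans i≤n n≤N))))

candidate : ℕ → ℕ → ℕ → ℕ
candidate A a k = a ℕ.+ k ℕ.* A

candidatesBelow : ℕ → ℕ → ℕ → ℕ → Bool
candidatesBelow A a zero    = λ _ → false
candidatesBelow A a (suc k) = mark (candidate A a k) (candidatesBelow A a k)

term-zero : ∀ r A a → term r A a 0 ≗ oneS
term-zero r A a n rewrite ℕP.*-zeroʳ A = trans (monomial-⊛-≥ 0 (oneS ⊛ oneS) n z≤n) (⊛-identityˡ oneS n)

term-suc : ∀ r A a k →
  term r A a (suc k) ≗ (term r A a k ⊛ nonfreeRatio (candidate A a k) ((r ∸ 2) ℕ.* candidate A a k))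
term-suc r A a k = begin
  monomial (A ℕ.* (suc k C 2) ℕ.+ suc k ℕ.* a) ⊛
    ((ip ⊛ i₊) ⊛ (pp ⊛ onePlus ((r ∸ 2) ℕ.* a ℕ.+ k ℕ.* ((r ∸ 2) ℕ.* A))))
    ≈⟨ ⊛-cong (λ n → cong (λ e → monomial e n) exponent)
              (⊛-congʳ (ip ⊛ i₊) (⊛-congʳ pp (λ n → cong (λ e → onePlus e n) pochExponent))) ⟩
  monomial (e ℕ.+ v) ⊛ ((ip ⊛ i₊) ⊛ (pp ⊛ pₜ))
    ≈⟨ ⊛-congʳ (monomial (e ℕ.+ v)) (⊛-interchange ip i₊ pp pₜ) ⟩
  monomial (e ℕ.+ v) ⊛ ((ip ⊛ pp) ⊛ (i₊ ⊛ pₜ))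
    ≈⟨ ⊛-congˡ ((ip ⊛ pp) ⊛ (i₊ ⊛ pₜ)) (monomial-+ e v) ⟨
  (monomial e ⊛ monomial v) ⊛ ((ip ⊛ pp) ⊛ (i₊ ⊛ pₜ))
    ≈⟨ ⊛-interchange (monomial e) (monomial v) (ip ⊛ pp) (i₊ ⊛ pₜ) ⟩
  term r A a k ⊛ nonfreeRatio v ((r ∸ 2) ℕ.* v)
    ∎
  where
  open ≗-Reasoning
  v e : ℕ
  v = candidate A a k
  e = A ℕ.* (k C 2) ℕ.+ k ℕ.* a
  ip pp i₊ pₜ : Series
  ip = invPoch A a k
  pp = poch2 r A a k
  i₊ = invOnePlus v
  pₜ = onePlus ((r ∸ 2) ℕ.* v)
  C2-suc : suc k C 2 ≡ k ℕ.+ k C 2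
  C2-suc = trans (sym (nCk+nC[k+1]≡[n+1]C[k+1] k 1)) (cong (ℕ._+ k C 2) (nC1≡n k))
  exponent : A ℕ.* (suc k C 2) ℕ.+ suc k ℕ.* a ≡ e ℕ.+ v
  exponent rewrite C2-suc = solve A (k C 2) k a
    where
    solve : ∀ A c k a →
            A ℕ.* (k ℕ.+ c) ℕ.+ (a ℕ.+ k ℕ.* a) ≡ (A ℕ.* c ℕ.+ k ℕ.* a) ℕ.+ (a ℕ.+ k ℕ.* A)
    solve = ℕSolver.solve-∀
  pochExponent : (r ∸ 2) ℕ.* a ℕ.+ k ℕ.* ((r ∸ 2) ℕ.* A) ≡ (r ∸ 2) ℕ.* v
  pochExponent = solve (r ∸ 2) a k A
    where
    solve : ∀ t a k A → t ℕ.* a ℕ.+ k ℕ.* (t ℕ.* A) ≡ t ℕ.* (a ℕ.+ k ℕ.* A)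
    solve = ℕSolver.solve-∀

module _ (A′ a′ : ℕ) where

  private
    A a : ℕ
    A = suc A′
    a = suc a′

  candidate-injective : ∀ i k → candidate A a i ≡ candidate A a k → i ≡ k
  candidate-injective i k eq = ℕP.*-cancelʳ-≡ i k A (ℕP.+-cancelˡ-≡ a (i ℕ.* A) (k ℕ.* A) eq)

  candidate-mono-≤ : ∀ {i k} → i ≤ k → candidate A a i ≤ candidate A a k
  candidate-mono-≤ i≤k = ℕP.+-monoʳ-≤ a (ℕP.*-monoˡ-≤ A i≤k)

  candidatesBelow-false : ∀ k u → (∀ i → i < k → candidate A a i ≢ u) → candidatesBelow A a k u ≡ false
  candidatesBelow-false zero    u _ = refl
  candidatesBelow-false (suc k) u ≢u
    rewrite candidatesBelow-false k u (λ i i<k → ≢u i (ℕP.m≤n⇒m≤1+n i<k))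
          | dec-false (candidate A a k ℕP.≟ u) (≢u k ℕP.≤-refl) = refl

  candidate-notBelow : ∀ k → candidatesBelow A a k (candidate A a k) ≡ false
  candidate-notBelow k =
    candidatesBelow-false k (candidate A a k) λ i i<k eq → ℕP.<⇒≢ i<k (candidate-injective i k eq)

module _ (r A′ a′ : ℕ) where

  private
    A a : ℕ
    A = suc A′
    a = suc a′

  overpartGFUpTo-⊛-term : ∀ k N → (∀ i → i < k → candidate A a i ≤ N) →
                          (overpartGFUpTo N ⊛ term r A a k) ≗ restrictedGF (r ∸ 2) (candidatesBelow A a k) N
  overpartGFUpTo-⊛-term zero    N _ n =
    trans (⊛-congʳ (overpartGFUpTo N) (term-zero r A a) n) (⊛-identityʳ (overpartGFUpTo N) n)
  overpartGFUpTo-⊛-term (suc k) N below = begin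
    overpartGFUpTo N ⊛ term r A a (suc k)
      ≈⟨ ⊛-congʳ (overpartGFUpTo N) (term-suc r A a k) ⟩
    overpartGFUpTo N ⊛ (term r A a k ⊛ X)
      ≈⟨ ⊛-assoc (overpartGFUpTo N) (term r A a k) X ⟨
    (overpartGFUpTo N ⊛ term r A a k) ⊛ X
      ≈⟨ ⊛-congˡ X (overpartGFUpTo-⊛-term k N (λ i i<k → below i (ℕP.m≤n⇒m≤1+n i<k))) ⟩
    restrictedGF (r ∸ 2) (candidatesBelow A a k) N ⊛ X
      ≈⟨ restrictedGF-mark (r ∸ 2) (candidatesBelow A a k) (candidate A a k) N
                           (candidate-notBelow A′ a′ k) (s≤s z≤n) (below k ℕP.≤-refl) ⟩
    restrictedGF (r ∸ 2) (candidatesBelow A a (suc k)) N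
      ∎
    where
    open ≗-Reasoning
    X : Series
    X = nonfreeRatio (candidate A a k) ((r ∸ 2) ℕ.* candidate A a k)

  rhsCoeff-candidate : ∀ k n → rhsCoeff r A a (k ℕ.* A ℕ.+ a) n ≡ summand r A a k n
  rhsCoeff-candidate k n = trans
    (sumTo-single (k ℕ.* A ℕ.+ a) k (ℕP.≤-trans (ℕP.m≤m*n k A) (ℕP.m≤m+n (k ℕ.* A) a)) λ i _ i≢k →
      cong (if_then summand r A a i n else + 0)
        (dec-false (i ℕ.* A ℕ.+ a ℕP.≟ k ℕ.* A ℕ.+ a)
                   (i≢k ∘ ℕP.*-cancelʳ-≡ i k A ∘ ℕP.+-cancelʳ-≡ a (i ℕ.* A) (k ℕ.* A))))
    (cong (if_then summand r A a k n else + 0) (dec-true (k ℕ.* A ℕ.+ a ℕP.≟ k ℕ.* A ℕ.+ a) refl))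

  rhsCoeff-nonCandidate : ∀ m n → (∀ k → k ℕ.* A ℕ.+ a ≢ m) → rhsCoeff r A a m n ≡ + 0
  rhsCoeff-nonCandidate m n ≢m = sumTo-zero m λ k _ →
    cong (if_then summand r A a k n else + 0) (dec-false (k ℕ.* A ℕ.+ a ℕP.≟ m) (≢m k))

  rhsCoeff-restrictedGF : ∀ k n N → n ≤ N → candidate A a k ≤ N →
    rhsCoeff r A a (k ℕ.* A ℕ.+ a) n
      ≡ restrictedGF (r ∸ 2) (candidatesBelow A a k) N n ℤ.- restrictedGF (r ∸ 2) (candidatesBelow A a (suc k)) N n
  rhsCoeff-restrictedGF k n N n≤N candidate≤N = begin
    rhsCoeff r A a (k ℕ.* A ℕ.+ a) n
      ≡⟨ rhsCoeff-candidate k n ⟩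
    (overpartGF ⊛ (term r A a k ⊖ term r A a (suc k))) n
      ≡⟨ ⊛-distribˡ-⊖ overpartGF (term r A a k) (term r A a (suc k)) n ⟩
    (overpartGF ⊛ term r A a k) n ℤ.- (overpartGF ⊛ term r A a (suc k)) n
      ≡⟨ cong₂ ℤ._-_ (truncated k (ℕP.n≤1+n k)) (truncated (suc k) ℕP.≤-refl) ⟩
    restrictedGF (r ∸ 2) (candidatesBelow A a k) N n ℤ.- restrictedGF (r ∸ 2) (candidatesBelow A a (suc k)) N n
      ∎
    where
    open ≡-Reasoning
    truncated : ∀ j → j ≤ suc k → (overpartGF ⊛ term r A a j) n ≡ restrictedGF (r ∸ 2) (candidatesBelow A a j) N n
    truncated j j≤1+k = trans (overpartGF-⊛-truncate n N (term r A a j) n≤N)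
      (overpartGFUpTo-⊛-term j N (λ i i<j →
         ℕP.≤-trans (candidate-mono-≤ A′ a′ (ℕP.≤-pred (ℕP.≤-trans i<j j≤1+k))) candidate≤N) n)

concatUpTo : {X : Set} → ℕ → (ℕ → List X) → List X
concatUpTo zero    h = h 0
concatUpTo (suc n) h = concatUpTo n h ++ h (suc n)

countᵇ : {X : Set} → (X → Bool) → List X → ℕ
countᵇ p []       = 0
countᵇ p (x ∷ xs) = if p x then suc (countᵇ p xs) else countᵇ p xs

module _ {X : Set} where

  countᵇ-++ : ∀ (p : X → Bool) xs ys → countᵇ p (xs ++ ys) ≡ countᵇ p xs ℕ.+ countᵇ p ys
  countᵇ-++ p []       ys = refl
  countᵇ-++ p (x ∷ xs) ys with p x
  ... | true  = cong suc (countᵇ-++ p xs ys)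
  ... | false = countᵇ-++ p xs ys

  countᵇ-concatUpTo : ∀ (p : X → Bool) n h → + countᵇ p (concatUpTo n h) ≡ sumTo n (λ i → + countᵇ p (h i))
  countᵇ-concatUpTo p zero    h = refl
  countᵇ-concatUpTo p (suc n) h = begin
    + countᵇ p (concatUpTo n h ++ h (suc n))
      ≡⟨ cong +_ (countᵇ-++ p (concatUpTo n h) (h (suc n))) ⟩
    + (countᵇ p (concatUpTo n h) ℕ.+ countᵇ p (h (suc n)))
      ≡⟨ ℤP.pos-+ (countᵇ p (concatUpTo n h)) _ ⟩
    + countᵇ p (concatUpTo n h) ℤ.+ + countᵇ p (h (suc n))
      ≡⟨ cong (ℤ._+ + countᵇ p (h (suc n))) (countᵇ-concatUpTo p n h) ⟩
    sumTo (suc n) (λ i → + countᵇ p (h i))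
      ∎
    where open ≡-Reasoning

  countᵇ-if : ∀ (p : X → Bool) b xs → + countᵇ p (if b then xs else []) ≡ (if b then + countᵇ p xs else + 0)
  countᵇ-if p true  xs = refl
  countᵇ-if p false xs = refl

  countᵇ-cong : ∀ {p q : X → Bool} xs → All (λ x → p x ≡ q x) xs → countᵇ p xs ≡ countᵇ q xs
  countᵇ-cong         []       []           = refl
  countᵇ-cong {q = q} (x ∷ xs) (px≡qx ∷ eqs) rewrite px≡qx =
    cong (λ n → if q x then suc n else n) (countᵇ-cong xs eqs)

  countᵇ-∧ : ∀ b (q : X → Bool) xs → countᵇ (λ x → b ∧ q x) xs ≡ (if b then countᵇ q xs else 0)
  countᵇ-∧ true  q xs       = refl
  countᵇ-∧ false q []       = refl
  countᵇ-∧ false q (x ∷ xs) = countᵇ-∧ false q xs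

  All-concatUpTo : ∀ {P : X → Set} n h → (∀ i → All P (h i)) → All P (concatUpTo n h)
  All-concatUpTo zero    h all = all 0
  All-concatUpTo (suc n) h all = AllP.++⁺ (All-concatUpTo n h all) (all (suc n))

countᵇ-map : ∀ {X Y : Set} (p : Y → Bool) (f : X → Y) xs → countᵇ p (map f xs) ≡ countᵇ (p ∘ f) xs
countᵇ-map p f []       = refl
countᵇ-map p f (x ∷ xs) = cong (λ n → if p (f x) then suc n else n) (countᵇ-map p f xs)

countᵇ-∧-split : ∀ {X : Set} (p q : X → Bool) xs →
                 countᵇ (λ x → p x ∧ q x) xs ℕ.+ countᵇ (λ x → p x ∧ not (q x)) xs ≡ countᵇ p xs
countᵇ-∧-split p q []       = refl
countᵇ-∧-split p q (x ∷ xs) with p x | q x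
... | true  | true  = cong suc (countᵇ-∧-split p q xs)
... | true  | false = trans (ℕP.+-suc _ _) (cong suc (countᵇ-∧-split p q xs))
... | false | _     = countᵇ-∧-split p q xs

countᵇ-false : ∀ {X : Set} (xs : List X) → countᵇ (λ _ → false) xs ≡ 0
countᵇ-false []       = refl
countᵇ-false (x ∷ xs) = countᵇ-false xs

m+n≡o⇒+m≡+o-+n : ∀ x y z → x ℕ.+ y ≡ z → + x ≡ + z ℤ.- + y
m+n≡o⇒+m≡+o-+n x y z refl = trans (solve (+ x) (+ y)) (cong (ℤ._- + y) (sym (ℤP.pos-+ x y)))
  where
  solve : ∀ i j → i ≡ (i ℤ.+ j) ℤ.- j
  solve = ℤSolver.solve-∀

countᵇ-concatMap-map : ∀ {X Y Z : Set} (p : Z → Bool) (g : X → Bool) (q : Y → Bool) (f : X → Y → Z) xs ys →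
  All (λ x → All (λ y → p (f x y) ≡ g x ∧ q y) ys) xs →
  countᵇ p (concatMap (λ x → map (f x) ys) xs) ≡ countᵇ g xs ℕ.* countᵇ q ys
countᵇ-concatMap-map p g q f []       ys []            = refl
countᵇ-concatMap-map p g q f (x ∷ xs) ys (pf≡ ∷ pfs≡) = begin
  countᵇ p (map (f x) ys ++ concatMap (λ x → map (f x) ys) xs)
    ≡⟨ countᵇ-++ p (map (f x) ys) _ ⟩
  countᵇ p (map (f x) ys) ℕ.+ countᵇ p (concatMap (λ x → map (f x) ys) xs)
    ≡⟨ cong₂ ℕ._+_ (trans (countᵇ-map p (f x) ys) (trans (countᵇ-cong ys pf≡) (countᵇ-∧ (g x) q ys)))
                   (countᵇ-concatMap-map p g q f xs ys pfs≡) ⟩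
  (if g x then countᵇ q ys else 0) ℕ.+ countᵇ g xs ℕ.* countᵇ q ys
    ≡⟨ distrib (g x) ⟩
  countᵇ g (x ∷ xs) ℕ.* countᵇ q ys
    ∎
  where
  open ≡-Reasoning
  distrib : ∀ b → (if b then countᵇ q ys else 0) ℕ.+ countᵇ g xs ℕ.* countᵇ q ys
                ≡ (if b then suc (countᵇ g xs) else countᵇ g xs) ℕ.* countᵇ q ys
  distrib true  = refl
  distrib false = refl

not-<ᵇ : ∀ k t → not (k <ᵇ t) ≡ (t ≤ᵇ k)
not-<ᵇ k       zero    = refl
not-<ᵇ zero    (suc t) = refl
not-<ᵇ (suc k) (suc t) = trans (not-<ᵇ k t) (<ᵇ-suc t)
  where
  <ᵇ-suc : ∀ t → (t ≤ᵇ k) ≡ (t <ᵇ suc k)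
  <ᵇ-suc zero    = refl
  <ᵇ-suc (suc t) = refl

PartsAre : (ℕ → Set) → List Part → Set
PartsAre P = All (P ∘ proj₁)

-- Defs spells out its own disjunction in hasOverlined; this turns it into Data.Bool's.
hasOverlined-∷ : ∀ w v o l → hasOverlined w ((v , o) ∷ l) ≡ (o ∧ (v ≡ᵇ w)) ∨ hasOverlined w l
hasOverlined-∷ w v false l = refl
hasOverlined-∷ w v true  l with v ≡ᵇ w
... | true  = refl
... | false = refl

hasOverlined-++ : ∀ w xs ys → hasOverlined w (xs ++ ys) ≡ hasOverlined w xs ∨ hasOverlined w ys
hasOverlined-++ w []             ys = refl
hasOverlined-++ w ((v , o) ∷ xs) ys = begin
  hasOverlined w ((v , o) ∷ (xs ++ ys))                    ≡⟨ hasOverlined-∷ w v o (xs ++ ys) ⟩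
  (o ∧ (v ≡ᵇ w)) ∨ hasOverlined w (xs ++ ys)               ≡⟨ cong ((o ∧ (v ≡ᵇ w)) ∨_) (hasOverlined-++ w xs ys) ⟩
  (o ∧ (v ≡ᵇ w)) ∨ (hasOverlined w xs ∨ hasOverlined w ys) ≡⟨ BoolP.∨-assoc (o ∧ (v ≡ᵇ w)) _ _ ⟨
  ((o ∧ (v ≡ᵇ w)) ∨ hasOverlined w xs) ∨ hasOverlined w ys ≡⟨ cong (_∨ hasOverlined w ys) (hasOverlined-∷ w v o xs) ⟨
  hasOverlined w ((v , o) ∷ xs) ∨ hasOverlined w ys        ∎
  where open ≡-Reasoning

countPlain-++ : ∀ w xs ys → countPlain w (xs ++ ys) ≡ countPlain w xs ℕ.+ countPlain w ys
countPlain-++ w []                 ys = refl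
countPlain-++ w ((v , true)  ∷ xs) ys = countPlain-++ w xs ys
countPlain-++ w ((v , false) ∷ xs) ys rewrite countPlain-++ w xs ys =
  sym (ℕP.+-assoc (if v ≡ᵇ w then 1 else 0) (countPlain w xs) (countPlain w ys))

hasOverlined-absent : ∀ w xs → PartsAre (_≢ w) xs → hasOverlined w xs ≡ false
hasOverlined-absent w []             []            = refl
hasOverlined-absent w ((v , o) ∷ xs) (v≢w ∷ absent)
  rewrite hasOverlined-∷ w v o xs | dec-false (v ℕP.≟ w) v≢w | BoolP.∧-zeroʳ o = hasOverlined-absent w xs absent

countPlain-absent : ∀ w xs → PartsAre (_≢ w) xs → countPlain w xs ≡ 0
countPlain-absent w []                 []             = refl
countPlain-absent w ((v , true)  ∷ xs) (_    ∷ absent) = countPlain-absent w xs absent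
countPlain-absent w ((v , false) ∷ xs) (v≢w ∷ absent)
  rewrite dec-false (v ℕP.≟ w) v≢w = countPlain-absent w xs absent

free-++-absentʳ : ∀ r w xs ys → PartsAre (_≢ w) ys → free r w (xs ++ ys) ≡ free r w xs
free-++-absentʳ r w xs ys absent
  rewrite hasOverlined-++ w xs ys | hasOverlined-absent w ys absent | BoolP.∨-identityʳ (hasOverlined w xs)
        | countPlain-++ w xs ys | countPlain-absent w ys absent | ℕP.+-identityʳ (countPlain w xs) = refl

free-++-absentˡ : ∀ r w xs ys → PartsAre (_≢ w) xs → free r w (xs ++ ys) ≡ free r w ys
free-++-absentˡ r w xs ys absent
  rewrite hasOverlined-++ w xs ys | hasOverlined-absent w xs absent
        | countPlain-++ w xs ys | countPlain-absent w xs absent = refl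

-- Enumerating overpartitions with bounded parts

plain : ℕ → ℕ → List Part
plain v k = replicate k (v , false)

blocks : ℕ → ℕ → List (List Part)
blocks v zero    = [] ∷ []
blocks v (suc k) = plain v (suc k) ∷ ((v , true) ∷ plain v k) ∷ []

blocksOfSize : ℕ → ℕ → List (List Part)
blocksOfSize v j = concatUpTo j (λ k → if k ℕ.* v ≡ᵇ j then blocks v k else [])

-- An overpartition of n with parts ≤ N + 1 is a block of parts N + 1 of size n - i followed by an
-- overpartition of i with parts ≤ N.
overpartitionsUpTo : ℕ → ℕ → List (List Part)
overpartitionsUpTo zero    zero    = [] ∷ []
overpartitionsUpTo zero    (suc n) = []
overpartitionsUpTo (suc N) n =
  concatUpTo n (λ i → concatMap (λ b → map (b ++_) (overpartitionsUpTo N i)) (blocksOfSize (suc N) (n ∸ i)))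

plain-parts : ∀ v k → PartsAre (_≡ v) (plain v k)
plain-parts v zero    = []
plain-parts v (suc k) = refl ∷ plain-parts v k

blocks-parts : ∀ v k → All (PartsAre (_≡ v)) (blocks v k)
blocks-parts v zero    = [] ∷ []
blocks-parts v (suc k) = plain-parts v (suc k) ∷ (refl ∷ plain-parts v k) ∷ []

blocksOfSize-parts : ∀ v j → All (PartsAre (_≡ v)) (blocksOfSize v j)
blocksOfSize-parts v j = All-concatUpTo j _ λ k → parts k (k ℕ.* v ≡ᵇ j)
  where
  parts : ∀ k b → All (PartsAre (_≡ v)) (if b then blocks v k else [])
  parts k true  = blocks-parts v k
  parts k false = []

overpartitionsUpTo-parts : ∀ N n → All (PartsAre (_≤ N)) (overpartitionsUpTo N n)
overpartitionsUpTo-parts zero    zero    = [] ∷ []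
overpartitionsUpTo-parts zero    (suc n) = []
overpartitionsUpTo-parts (suc N) n = All-concatUpTo n _ λ i →
  AllP.concat⁺ (AllP.map⁺ (All.map (λ {b} b≡ → AllP.map⁺ (All.tabulate λ {π} π∈ →
    AllP.++⁺ (All.map ℕP.≤-reflexive b≡)
             (All.map ℕP.m≤n⇒m≤1+n (All.lookup (overpartitionsUpTo-parts N i) π∈))))
    (blocksOfSize-parts (suc N) (n ∸ i))))

countPlain-plain : ∀ v k → countPlain v (plain v k) ≡ k
countPlain-plain v zero    = refl
countPlain-plain v (suc k) rewrite dec-true (v ℕP.≟ v) refl = cong suc (countPlain-plain v k)

hasOverlined-plain : ∀ v k → hasOverlined v (plain v k) ≡ false
hasOverlined-plain v zero    = refl
hasOverlined-plain v (suc k) = hasOverlined-plain v k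

module _ (t : ℕ) where

  private
    r : ℕ
    r = 2 ℕ.+ t

  admissible : Bool → ℕ → List Part → Bool
  admissible marked v π = if marked then not (free r v π) else true

  markedNonfree : (ℕ → Bool) → ℕ → List Part → Bool
  markedNonfree c zero    π = true
  markedNonfree c (suc N) π = admissible (c (suc N)) (suc N) π ∧ markedNonfree c N π

  markedNonfree-absentˡ : ∀ c M b π → (∀ w → 1 ≤ w → w ≤ M → PartsAre (_≢ w) b) →
                          markedNonfree c M (b ++ π) ≡ markedNonfree c M π
  markedNonfree-absentˡ c zero    b π absent = refl
  markedNonfree-absentˡ c (suc M) b π absent
    rewrite free-++-absentˡ r (suc M) b π (absent (suc M) (s≤s z≤n) ℕP.≤-refl)
          | markedNonfree-absentˡ c M b π (λ w 1≤w w≤M → absent w 1≤w (ℕP.m≤n⇒m≤1+n w≤M)) = refl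

  markedNonfree-++ : ∀ c N b π → PartsAre (_≡ suc N) b → PartsAre (_≤ N) π →
                     markedNonfree c (suc N) (b ++ π) ≡ admissible (c (suc N)) (suc N) b ∧ markedNonfree c N π
  markedNonfree-++ c N b π b≡ π≤
    rewrite free-++-absentʳ r (suc N) b π (All.map (λ v≤N → ℕP.<⇒≢ (s≤s v≤N)) π≤)
          | markedNonfree-absentˡ c N b π (λ w _ w≤N → All.map (λ { refl → ℕP.>⇒≢ (s≤s w≤N) }) b≡) = refl

  markedNonfree-cong : ∀ {c c′} M π → (∀ u → u ≤ M → c u ≡ c′ u) →
                       markedNonfree c M π ≡ markedNonfree c′ M π
  markedNonfree-cong zero    π c≡c′ = refl
  markedNonfree-cong (suc M) π c≡c′
    rewrite c≡c′ (suc M) ℕP.≤-refl | markedNonfree-cong M π (λ u u≤M → c≡c′ u (ℕP.m≤n⇒m≤1+n u≤M)) = refl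

  markedNonfree-none : ∀ N π → markedNonfree (λ _ → false) N π ≡ true
  markedNonfree-none zero    π = refl
  markedNonfree-none (suc N) π = markedNonfree-none N π

  markedNonfree-mark : ∀ c v M π → c v ≡ false → 1 ≤ v → v ≤ M →
                       markedNonfree (mark v c) M π ≡ markedNonfree c M π ∧ not (free r v π)
  markedNonfree-mark c v zero    π cv≡false 1≤v v≤0 = ⊥-elim (ℕP.<-irrefl refl (ℕP.≤-trans 1≤v v≤0))
  markedNonfree-mark c v (suc M) π cv≡false 1≤v v≤1+M with v ℕP.≟ suc M
  ... | yes refl
    rewrite cv≡false | dec-true (v ℕP.≟ v) refl
          | markedNonfree-cong M π (λ u u≤M → mark-other {v} {u} c (ℕP.>⇒≢ (s≤s u≤M)))
    = BoolP.∧-comm (not (free r v π)) (markedNonfree c M π)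
  ... | no  v≢1+M
    rewrite mark-other c v≢1+M | markedNonfree-mark c v M π cv≡false 1≤v (ℕP.≤-pred (ℕP.≤∧≢⇒< v≤1+M v≢1+M))
    = sym (BoolP.∧-assoc (admissible (c (suc M)) (suc M) π) (markedNonfree c M π) _)

  free-plain : ∀ v k → free r v (plain v (suc k)) ≡ (k <ᵇ t)
  free-plain v k rewrite hasOverlined-plain v k | dec-true (v ℕP.≟ v) refl | countPlain-plain v k = refl

  free-overlined : ∀ v k → free r v ((v , true) ∷ plain v k) ≡ false
  free-overlined v k rewrite hasOverlined-∷ v v true (plain v k) | dec-true (v ℕP.≟ v) refl = refl

  countᵇ-blocks : ∀ marked v k →
    + countᵇ (admissible marked v) (blocks v k) ≡ (if marked then nonfreeBlockCount t k else blockCount k)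
  countᵇ-blocks false v zero    = refl
  countᵇ-blocks false v (suc k) = refl
  countᵇ-blocks true  v zero    = refl
  countᵇ-blocks true  v (suc k) rewrite free-plain v k | free-overlined v k | not-<ᵇ k t with t ≤ᵇ k
  ... | true  = refl
  ... | false = refl

  factor-inPowersOf : ∀ marked v .{{_ : ℕ.NonZero v}} →
                      factor t marked v ≗ inPowersOf v (λ k → + countᵇ (admissible marked v) (blocks v k))
  factor-inPowersOf false v j =
    trans (overpartFactor-inPowersOf v j) (inPowersOf-cong v (λ k → sym (countᵇ-blocks false v k)) j)
  factor-inPowersOf true  v j =
    trans (nonfreeFactor-inPowersOf v t j) (inPowersOf-cong v (λ k → sym (countᵇ-blocks true v k)) j)

  countᵇ-blocksOfSize : ∀ marked v j →
    + countᵇ (admissible marked v) (blocksOfSize v j)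
      ≡ inPowersOf v (λ k → + countᵇ (admissible marked v) (blocks v k)) j
  countᵇ-blocksOfSize marked v j = trans (countᵇ-concatUpTo (admissible marked v) j _)
    (sumTo-cong j λ k _ → countᵇ-if (admissible marked v) (k ℕ.* v ≡ᵇ j) (blocks v k))

  countᵇ-markedNonfree : ∀ c N n → + countᵇ (markedNonfree c N) (overpartitionsUpTo N n) ≡ restrictedGF t c N n
  countᵇ-markedNonfree c zero    zero    = refl
  countᵇ-markedNonfree c zero    (suc n) = refl
  countᵇ-markedNonfree c (suc N) n = begin
    + countᵇ (markedNonfree c (suc N)) (overpartitionsUpTo (suc N) n)
      ≡⟨ countᵇ-concatUpTo (markedNonfree c (suc N)) n _ ⟩
    sumTo n (λ i → + countᵇ (markedNonfree c (suc N)) (concatMap (λ b → map (b ++_) (E i)) (B (n ∸ i))))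
      ≡⟨ sumTo-cong n (λ i _ → cong +_ (countᵇ-concatMap-map _ g _ _++_ (B (n ∸ i)) (E i) (split i))) ⟩
    sumTo n (λ i → + (countᵇ g (B (n ∸ i)) ℕ.* countᵇ (markedNonfree c N) (E i)))
      ≡⟨ sumTo-cong n (λ i _ →
           trans (ℤP.pos-* (countᵇ g (B (n ∸ i))) _) (ℤP.*-comm (+ countᵇ g (B (n ∸ i))) _)) ⟩
    sumTo n (λ i → + countᵇ (markedNonfree c N) (E i) ℤ.* + countᵇ g (B (n ∸ i)))
      ≡⟨ sumTo-cong n (λ i _ → cong₂ ℤ._*_ (countᵇ-markedNonfree c N i)
                                            (trans (countᵇ-blocksOfSize (c (suc N)) (suc N) (n ∸ i))
                                                   (sym (factor-inPowersOf (c (suc N)) (suc N) (n ∸ i))))) ⟩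
    restrictedGF t c (suc N) n
      ∎
    where
    open ≡-Reasoning
    E B : ℕ → List (List Part)
    E = overpartitionsUpTo N
    B = blocksOfSize (suc N)
    g : List Part → Bool
    g = admissible (c (suc N)) (suc N)
    split : ∀ i →
      All (λ b → All (λ π → markedNonfree c (suc N) (b ++ π) ≡ g b ∧ markedNonfree c N π) (E i)) (B (n ∸ i))
    split i = All.map (λ b≡ → All.map (markedNonfree-++ c N _ _ b≡) (overpartitionsUpTo-parts N i))
                      (blocksOfSize-parts (suc N) (n ∸ i))

-- The smallest free candidate

injective-occurrences-≤-length : ∀ {X Y : Set} (key : X → Y) (f : ℕ → Y) → (∀ {i j} → f i ≡ f j → i ≡ j) →
  ∀ k xs → (∀ i → i < k → Any ((_≡ f i) ∘ key) xs) → k ≤ length xs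
injective-occurrences-≤-length key f f-injective k xs occurs = FinP.injective⇒≤ position-injective
  where
  position : Fin k → Fin (length xs)
  position i = index (occurs (Fin.toℕ i) (FinP.toℕ<n i))
  position-injective : ∀ {i j} → position i ≡ position j → i ≡ j
  position-injective {i} {j} eq = FinP.toℕ-injective (f-injective (begin
    f (Fin.toℕ i)                    ≡⟨ lookup-index (occurs (Fin.toℕ i) (FinP.toℕ<n i)) ⟨
    key (lookup xs (position i))     ≡⟨ cong (key ∘ lookup xs) eq ⟩
    key (lookup xs (position j))     ≡⟨ lookup-index (occurs (Fin.toℕ j) (FinP.toℕ<n j)) ⟩
    f (Fin.toℕ j)                    ∎))
    where open ≡-Reasoning

Occurs : ℕ → List Part → Set
Occurs w = Any ((_≡ w) ∘ proj₁)

hasOverlined⇒Occurs : ∀ w π → hasOverlined w π ≡ true → Occurs w π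
hasOverlined⇒Occurs w ((v , o) ∷ π) hasOv with v ℕP.≟ w
... | yes v≡w = here v≡w
... | no  v≢w = there (hasOverlined⇒Occurs w π (trans (sym (hasOverlined-tail o)) hasOv))
  where
  hasOverlined-tail : ∀ o → hasOverlined w ((v , o) ∷ π) ≡ hasOverlined w π
  hasOverlined-tail o rewrite hasOverlined-∷ w v o π | dec-false (v ℕP.≟ w) v≢w | BoolP.∧-zeroʳ o = refl

countPlain⇒Occurs : ∀ w π → 1 ≤ countPlain w π → Occurs w π
countPlain⇒Occurs w ((v , true)  ∷ π) 1≤count = there (countPlain⇒Occurs w π 1≤count)
countPlain⇒Occurs w ((v , false) ∷ π) 1≤count with v ℕP.≟ w
... | yes v≡w = here v≡w
... | no  v≢w rewrite dec-false (v ℕP.≟ w) v≢w = there (countPlain⇒Occurs w π 1≤count)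

nonfree⇒Occurs : ∀ t w π → free (2 ℕ.+ t) w π ≡ false → Occurs w π
nonfree⇒Occurs t w π nonfree with hasOverlined w π in hasOv
... | true  = hasOverlined⇒Occurs w π hasOv
... | false with countPlain w π ℕP.<? suc t
...   | yes count<r-1 = ⊥-elim (subst T nonfree (ℕP.<⇒<ᵇ count<r-1))
...   | no  count≮r-1 = countPlain⇒Occurs w π (ℕP.≤-trans (s≤s z≤n) (ℕP.≮⇒≥ count≮r-1))

module _ (t A′ a′ : ℕ) where

  private
    r A a : ℕ
    r = 2 ℕ.+ t
    A = suc A′
    a = suc a′
    cand : ℕ → ℕ
    cand = candidate A a

  nonfreeBelow : ℕ → List Part → Bool
  nonfreeBelow zero    π = true
  nonfreeBelow (suc k) π = nonfreeBelow k π ∧ not (free r (cand k) π)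

  nonfreeBelow⇒ : ∀ k π → nonfreeBelow k π ≡ true → ∀ i → i < k → free r (cand i) π ≡ false
  nonfreeBelow⇒ (suc k) π below i i<1+k with nonfreeBelow k π in belowₖ | free r (cand k) π in freeₖ
  nonfreeBelow⇒ (suc k) π ()    i i<1+k | false | _
  nonfreeBelow⇒ (suc k) π ()    i i<1+k | true  | true
  nonfreeBelow⇒ (suc k) π refl  i i<1+k | true  | false with ℕP.m≤n⇒m<n∨m≡n (ℕP.≤-pred i<1+k)
  ... | inj₁ i<k  = nonfreeBelow⇒ k π belowₖ i i<k
  ... | inj₂ refl = freeₖ

  ⇒nonfreeBelow : ∀ k π → (∀ i → i < k → free r (cand i) π ≡ false) → nonfreeBelow k π ≡ true
  ⇒nonfreeBelow zero    π nonfree = refl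
  ⇒nonfreeBelow (suc k) π nonfree
    rewrite ⇒nonfreeBelow k π (λ i i<k → nonfree i (ℕP.m≤n⇒m≤1+n i<k)) | nonfree k ℕP.≤-refl = refl

  -- At most length π candidates are not free, since each of them occurs in π.
  mesSearch-spec : ∀ π f j → (∀ i → i < j → free r (cand i) π ≡ false) → length π < j ℕ.+ f →
    Σ ℕ λ k → mesSearch r A a π f j ≡ cand k × nonfreeBelow k π ≡ true × free r (cand k) π ≡ true
  mesSearch-spec π zero j nonfree length<j+0 =
    ⊥-elim (ℕP.<⇒≱ length<j (injective-occurrences-≤-length proj₁ cand (candidate-injective A′ a′ _ _) j π
                               (λ i i<j → nonfree⇒Occurs t (cand i) π (nonfree i i<j))))
    where
    length<j : length π < j
    length<j = subst (length π <_) (ℕP.+-identityʳ j) length<j+0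
  mesSearch-spec π (suc f) j nonfree length<j+1+f with free r (cand j) π in freeⱼ
  ... | true  = j , refl , ⇒nonfreeBelow j π nonfree , freeⱼ
  ... | false = mesSearch-spec π f (suc j) nonfree′ (subst (length π <_) (ℕP.+-suc j f) length<j+1+f)
    where
    nonfree′ : ∀ i → i < suc j → free r (cand i) π ≡ false
    nonfree′ i i<1+j with ℕP.m≤n⇒m<n∨m≡n (ℕP.≤-pred i<1+j)
    ... | inj₁ i<j  = nonfree i i<j
    ... | inj₂ refl = freeⱼ

  mes-spec : ∀ π → Σ ℕ λ k → mes r A a π ≡ cand k × nonfreeBelow k π ≡ true × free r (cand k) π ≡ true
  mes-spec π = mesSearch-spec π (suc (length π)) 0 (λ _ ()) ℕP.≤-refl

  smallestFree-unique : ∀ π k l → nonfreeBelow k π ≡ true → free r (cand k) π ≡ true →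
                        nonfreeBelow l π ≡ true → free r (cand l) π ≡ true → k ≡ l
  smallestFree-unique π k l belowₖ freeₖ belowₗ freeₗ with ℕP.<-cmp k l
  ... | tri< k<l _ _ = ⊥-elim (subst T (nonfreeBelow⇒ l π belowₗ k k<l) (subst T (sym freeₖ) tt))
  ... | tri≈ _ k≡l _ = k≡l
  ... | tri> _ _ l<k = ⊥-elim (subst T (nonfreeBelow⇒ k π belowₖ l l<k) (subst T (sym freeₗ) tt))

  mes≡candidate : ∀ π k → (mes r A a π ≡ᵇ (k ℕ.* A ℕ.+ a)) ≡ (nonfreeBelow k π ∧ free r (cand k) π)
  mes≡candidate π k with mes-spec π
  ... | l , mes≡ , belowₗ , freeₗ rewrite mes≡ with k ℕP.≟ l
  ...   | yes refl rewrite belowₗ | freeₗ = dec-true (cand k ℕP.≟ k ℕ.* A ℕ.+ a) (ℕP.+-comm a (k ℕ.* A))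
  ...   | no  k≢l rewrite dec-false (cand l ℕP.≟ k ℕ.* A ℕ.+ a)
                            (λ eq → k≢l (candidate-injective A′ a′ k l (trans (ℕP.+-comm a (k ℕ.* A)) (sym eq))))
    with nonfreeBelow k π in belowₖ | free r (cand k) π in freeₖ
  ...     | true  | true  = ⊥-elim (k≢l (smallestFree-unique π k l belowₖ freeₖ belowₗ freeₗ))
  ...     | true  | false = refl
  ...     | false | _     = refl

  mes≢nonCandidate : ∀ π m → (∀ k → k ℕ.* A ℕ.+ a ≢ m) → (mes r A a π ≡ᵇ m) ≡ false
  mes≢nonCandidate π m ≢m with mes-spec π
  ... | l , mes≡ , _ , _ rewrite mes≡ = dec-false (cand l ℕP.≟ m) (≢m l ∘ trans (ℕP.+-comm (l ℕ.* A) a))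

-- Soundness, completeness and uniqueness of the enumeration

module _ {X : Set} where

  ∈-concatUpTo⁻ : ∀ {x : X} n h → x ∈ concatUpTo n h → Σ ℕ λ i → i ≤ n × x ∈ h i
  ∈-concatUpTo⁻ zero    h x∈ = 0 , z≤n , x∈
  ∈-concatUpTo⁻ (suc n) h x∈ with ∈P.∈-++⁻ (concatUpTo n h) x∈
  ... | inj₁ x∈′ = let i , i≤n , x∈hi = ∈-concatUpTo⁻ n h x∈′ in i , ℕP.m≤n⇒m≤1+n i≤n , x∈hi
  ... | inj₂ x∈′ = suc n , ℕP.≤-refl , x∈′

  ∈-concatUpTo⁺ : ∀ {x : X} n h i → i ≤ n → x ∈ h i → x ∈ concatUpTo n h
  ∈-concatUpTo⁺ zero    h .zero z≤n x∈ = x∈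
  ∈-concatUpTo⁺ (suc n) h i i≤1+n x∈ with i ℕP.≟ suc n
  ... | yes refl = ∈P.∈-++⁺ʳ (concatUpTo n h) x∈
  ... | no  i≢1+n = ∈P.∈-++⁺ˡ (∈-concatUpTo⁺ n h i (ℕP.≤-pred (ℕP.≤∧≢⇒< i≤1+n i≢1+n)) x∈)

  ∈-if⁻ : ∀ {x : X} b xs → x ∈ (if b then xs else []) → b ≡ true × x ∈ xs
  ∈-if⁻ true xs x∈ = refl , x∈

size-++ : ∀ xs ys → size (xs ++ ys) ≡ size xs ℕ.+ size ys
size-++ []             ys = refl
size-++ ((v , o) ∷ xs) ys rewrite size-++ xs ys = sym (ℕP.+-assoc v (size xs) (size ys))

size-plain : ∀ v k → size (plain v k) ≡ k ℕ.* v
size-plain v zero    = refl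
size-plain v (suc k) = cong (v ℕ.+_) (size-plain v k)

data BlockShape (v : ℕ) : List Part → Set where
  empty    : BlockShape v []
  nonempty : ∀ o k → BlockShape v ((v , o) ∷ plain v k)

blocks-shape : ∀ v k {b} → b ∈ blocks v k → BlockShape v b
blocks-shape v zero    (here refl)         = empty
blocks-shape v (suc k) (here refl)         = nonempty false k
blocks-shape v (suc k) (there (here refl)) = nonempty true k

blocks-size : ∀ v k {b} → b ∈ blocks v k → size b ≡ k ℕ.* v
blocks-size v zero    (here refl)         = refl
blocks-size v (suc k) (here refl)         = size-plain v (suc k)
blocks-size v (suc k) (there (here refl)) = cong (v ℕ.+_) (size-plain v k)

blocks-length : ∀ v k {b} → b ∈ blocks v k → length b ≡ k
blocks-length v zero    (here refl)         = refl
blocks-length v (suc k) (here refl)         = cong suc (ListP.length-replicate k)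
blocks-length v (suc k) (there (here refl)) = cong suc (ListP.length-replicate k)

∈-blocksOfSize⁻ : ∀ v j {b} → b ∈ blocksOfSize v j → Σ ℕ λ k → k ℕ.* v ≡ j × b ∈ blocks v k
∈-blocksOfSize⁻ v j b∈ with ∈-concatUpTo⁻ j _ b∈
... | k , _ , b∈ₖ with ∈-if⁻ (k ℕ.* v ≡ᵇ j) (blocks v k) b∈ₖ
...   | kv≡ᵇj , b∈′ = k , ℕP.≡ᵇ⇒≡ (k ℕ.* v) j (subst T (sym kv≡ᵇj) tt) , b∈′

∈-blocksOfSize⁺ : ∀ v .{{_ : ℕ.NonZero v}} k {b} → b ∈ blocks v k → b ∈ blocksOfSize v (k ℕ.* v)
∈-blocksOfSize⁺ v k {b} b∈ = ∈-concatUpTo⁺ (k ℕ.* v) _ k (ℕP.m≤m*n k v)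
  (subst (λ c → b ∈ (if c then blocks v k else [])) (sym (dec-true (k ℕ.* v ℕP.≟ k ℕ.* v) refl)) b∈)

T-∧⁻ : ∀ x {y} → T (x ∧ y) → T x × T y
T-∧⁻ x = Equivalence.to (BoolP.T-∧ {x})

T-∧⁺ : ∀ x {y} → T x → T y → T (x ∧ y)
T-∧⁺ x tx ty = Equivalence.from (BoolP.T-∧ {x}) (tx , ty)

headStepOK : Part → List Part → Bool
headStepOK x []      = true
headStepOK x (y ∷ l) = stepOK x y

sortedOK-∷ : ∀ x l → sortedOK (x ∷ l) ≡ headStepOK x l ∧ sortedOK l
sortedOK-∷ x []      = refl
sortedOK-∷ x (y ∷ l) = refl

stepOK-< : ∀ {v w} o o′ → w < v → stepOK (v , o) (w , o′) ≡ true
stepOK-< {v} {w} o o′ w<v rewrite dec-true (w ℕP.<? v) w<v = refl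

stepOK-≡ : ∀ v o o′ → stepOK (v , o) (v , o′) ≡ not o′
stepOK-≡ v o o′ rewrite dec-false (v ℕP.<? v) (ℕP.<-irrefl refl) | dec-true (v ℕP.≟ v) refl = refl

stepOK⇒≤ : ∀ v o w o′ → T (stepOK (v , o) (w , o′)) → w ≤ v
stepOK⇒≤ v o w o′ ok with w ℕP.<? v
... | yes w<v = ℕP.<⇒≤ w<v
... | no  w≮v with w ℕP.≟ v
...   | yes w≡v = ℕP.≤-reflexive w≡v
...   | no  w≢v rewrite dec-false (w ℕP.<? v) w≮v | dec-false (w ℕP.≟ v) w≢v = ⊥-elim ok

sortedOK⇒bounded : ∀ v o ρ → T (sortedOK ((v , o) ∷ ρ)) → PartsAre (_≤ v) ρ
sortedOK⇒bounded v o []             _      = []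
sortedOK⇒bounded v o ((w , o′) ∷ ρ) sorted =
  w≤v ∷ All.map (λ u≤w → ℕP.≤-trans u≤w w≤v)
                (sortedOK⇒bounded w o′ ρ (proj₂ (T-∧⁻ (stepOK (v , o) (w , o′)) sorted)))
  where
  w≤v : w ≤ v
  w≤v = stepOK⇒≤ v o w o′ (proj₁ (T-∧⁻ (stepOK (v , o) (w , o′)) sorted))

positiveParts-++ : ∀ xs ys → positiveParts (xs ++ ys) ≡ positiveParts xs ∧ positiveParts ys
positiveParts-++ []             ys = refl
positiveParts-++ ((v , o) ∷ xs) ys rewrite positiveParts-++ xs ys = sym (BoolP.∧-assoc (0 <ᵇ v) (positiveParts xs) _)

positiveParts-plain : ∀ v k → positiveParts (plain (suc v) k) ≡ true
positiveParts-plain v zero    = refl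
positiveParts-plain v (suc k) = positiveParts-plain v k

sortedOK-block : ∀ N o k π → T (sortedOK π) → PartsAre (_≤ N) π →
                 T (sortedOK ((suc N , o) ∷ (plain (suc N) k ++ π)))
sortedOK-block N o zero    []             sorted π≤           = tt
sortedOK-block N o zero    ((w , o′) ∷ π) sorted (w≤N ∷ _)
  rewrite stepOK-< o o′ (s≤s w≤N) = sorted
sortedOK-block N o (suc k) π sorted π≤ rewrite stepOK-≡ (suc N) o false = sortedOK-block N false k π sorted π≤

isOverpartition-++ : ∀ N {b} π → BlockShape (suc N) b → T (isOverpartition π) → PartsAre (_≤ N) π →
                     T (isOverpartition (b ++ π))
isOverpartition-++ N π empty          isOP π≤ = isOP
isOverpartition-++ N π (nonempty o k) isOP π≤ =
  T-∧⁺ (positiveParts ((suc N , o) ∷ (plain (suc N) k ++ π))) positive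
       (sortedOK-block N o k π (proj₂ (T-∧⁻ (positiveParts π) isOP)) π≤)
  where
  positive : T (positiveParts ((suc N , o) ∷ (plain (suc N) k ++ π)))
  positive rewrite positiveParts-++ (plain (suc N) k) π | positiveParts-plain N k =
    proj₁ (T-∧⁻ (positiveParts π) isOP)

isOverpartition-tail : ∀ x π → T (isOverpartition (x ∷ π)) → T (isOverpartition π)
isOverpartition-tail (v , o) π isOP with T-∧⁻ ((0 <ᵇ v) ∧ positiveParts π) isOP
... | positive , sorted = T-∧⁺ (positiveParts π) (proj₂ (T-∧⁻ (0 <ᵇ v) positive))
                               (proj₂ (T-∧⁻ (headStepOK (v , o) π) (subst T (sortedOK-∷ (v , o) π) sorted)))

overpartitionsUpTo-sound : ∀ N n {π} → π ∈ overpartitionsUpTo N n → T (isOverpartition π) × size π ≡ n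
overpartitionsUpTo-sound zero    zero    (here refl) = tt , refl
overpartitionsUpTo-sound (suc N) n       π∈
  with i , i≤n , π∈ᵢ ← ∈-concatUpTo⁻ n _ π∈
  with b , b∈ , π∈map ← find (∈P.∈-concatMap⁻ _ {xs = blocksOfSize (suc N) (n ∸ i)} π∈ᵢ)
  with π′ , π′∈ , refl ← ∈P.∈-map⁻ (b ++_) π∈map
  with k , kv≡n-i , b∈ₖ ← ∈-blocksOfSize⁻ (suc N) (n ∸ i) b∈
  with isOP , size≡i ← overpartitionsUpTo-sound N i π′∈ =
  isOverpartition-++ N π′ (blocks-shape (suc N) k b∈ₖ) isOP (All.lookup (overpartitionsUpTo-parts N i) π′∈) ,
  (begin
    size (b ++ π′)          ≡⟨ size-++ b π′ ⟩
    size b ℕ.+ size π′      ≡⟨ cong₂ ℕ._+_ (trans (blocks-size (suc N) k b∈ₖ) kv≡n-i) size≡i ⟩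
    n ∸ i ℕ.+ i             ≡⟨ ℕP.m∸n+n≡m i≤n ⟩
    n                       ∎)
  where open ≡-Reasoning

data Decomposition (N : ℕ) : List Part → Set where
  decompose : ∀ {k b π} → b ∈ blocks (suc N) k → T (isOverpartition π) → PartsAre (_≤ N) π →
              Decomposition N (b ++ π)

decomposition : ∀ N π → T (isOverpartition π) → PartsAre (_≤ suc N) π → Decomposition N π
decomposition N []             isOP []        = decompose {k = 0} (here refl) isOP []
decomposition N ((v , o) ∷ ρ)  isOP (v≤ ∷ ρ≤) with v ℕP.≟ suc N
... | no v≢1+N =
  decompose {k = 0} (here refl) isOP (v≤N ∷ All.map (λ u≤v → ℕP.≤-trans u≤v v≤N) (sortedOK⇒bounded v o ρ sorted))
  where
  v≤N : v ≤ N
  v≤N = ℕP.≤-pred (ℕP.≤∧≢⇒< v≤ v≢1+N)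
  sorted : T (sortedOK ((v , o) ∷ ρ))
  sorted = proj₂ (T-∧⁻ (positiveParts ((v , o) ∷ ρ)) isOP)
... | yes refl with decomposition N ρ (isOverpartition-tail (v , o) ρ isOP) ρ≤
...   | decompose {zero}  (here refl)         isOPₚ π≤ = decompose {k = 1} (single o) isOPₚ π≤
  where
  single : ∀ o → ((v , o) ∷ []) ∈ blocks v 1
  single false = here refl
  single true  = there (here refl)
...   | decompose {suc k} (here refl)         isOPₚ π≤ = decompose {k = suc (suc k)} (longer o) isOPₚ π≤
  where
  longer : ∀ o → ((v , o) ∷ plain v (suc k)) ∈ blocks v (suc (suc k))
  longer false = here refl
  longer true  = there (here refl)
...   | decompose {suc k} {π = π′} (there (here refl)) isOPₚ π≤ =
  ⊥-elim (subst T (stepOK-≡ v o true) (proj₁ (T-∧⁻ (stepOK (v , o) (v , true)) sorted)))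
  where
  sorted : T (sortedOK ((v , o) ∷ (v , true) ∷ (plain v k ++ π′)))
  sorted = proj₂ (T-∧⁻ (positiveParts ((v , o) ∷ (v , true) ∷ (plain v k ++ π′))) isOP)

overpartitionsUpTo-complete : ∀ N π → T (isOverpartition π) → PartsAre (_≤ N) π →
                              π ∈ overpartitionsUpTo N (size π)
overpartitionsUpTo-complete zero    []            isOP π≤        = here refl
overpartitionsUpTo-complete zero    ((v , o) ∷ π) isOP (v≤0 ∷ _) rewrite ℕP.n≤0⇒n≡0 v≤0 = ⊥-elim isOP
overpartitionsUpTo-complete (suc N) π             isOP π≤ with decomposition N π isOP π≤
... | decompose {k} {b} {π′} b∈ isOP′ π′≤ =
  ∈-concatUpTo⁺ (size (b ++ π′)) _ (size π′)
    (subst (size π′ ≤_) (sym (size-++ b π′)) (ℕP.m≤n+m (size π′) (size b)))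
    (∈P.∈-concatMap⁺ _ (lose b∈blocksOfSize (∈P.∈-map⁺ (b ++_) (overpartitionsUpTo-complete N π′ isOP′ π′≤))))
  where
  blockSize : size (b ++ π′) ∸ size π′ ≡ k ℕ.* suc N
  blockSize = trans (cong (_∸ size π′) (size-++ b π′))
                    (trans (ℕP.m+n∸n≡m (size b) (size π′)) (blocks-size (suc N) k b∈))
  b∈blocksOfSize : b ∈ blocksOfSize (suc N) (size (b ++ π′) ∸ size π′)
  b∈blocksOfSize = subst (λ j → b ∈ blocksOfSize (suc N) j) (sym blockSize) (∈-blocksOfSize⁺ (suc N) k b∈)

module _ {X : Set} where

  Unique-concatUpTo : ∀ n (h : ℕ → List X) (label : X → ℕ) → (∀ i → i ≤ n → Unique (h i)) →
                      (∀ i {x} → i ≤ n → x ∈ h i → label x ≡ i) → Unique (concatUpTo n h)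
  Unique-concatUpTo zero    h label unique labelled = unique 0 z≤n
  Unique-concatUpTo (suc n) h label unique labelled =
    UniqueP.++⁺ (Unique-concatUpTo n h label (λ i i≤n → unique i (ℕP.m≤n⇒m≤1+n i≤n))
                                           (λ i i≤n → labelled i (ℕP.m≤n⇒m≤1+n i≤n)))
                (unique (suc n) ℕP.≤-refl) disjoint
    where
    disjoint : ∀ {x} → ¬ (x ∈ concatUpTo n h × x ∈ h (suc n))
    disjoint {x} (x∈ , x∈ₙ) with i , i≤n , x∈ᵢ ← ∈-concatUpTo⁻ n h x∈ =
      ℕP.<⇒≢ (s≤s i≤n) (trans (sym (labelled i (ℕP.m≤n⇒m≤1+n i≤n) x∈ᵢ)) (labelled (suc n) ℕP.≤-refl x∈ₙ))

  Unique-if : ∀ b (xs : List X) → Unique xs → Unique (if b then xs else [])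
  Unique-if true  xs unique = unique
  Unique-if false xs unique = []

Unique-concatMap : ∀ {X Y : Set} (f : X → List Y) xs (origin : Y → X) → Unique xs →
                   (∀ {x} → x ∈ xs → Unique (f x)) → (∀ {x y} → x ∈ xs → y ∈ f x → origin y ≡ x) →
                   Unique (concatMap f xs)
Unique-concatMap f []       origin []                 unique-f origins = []
Unique-concatMap f (x ∷ xs) origin (x∉xs ∷ unique) unique-f origins =
  UniqueP.++⁺ (unique-f (here refl))
              (Unique-concatMap f xs origin unique (unique-f ∘ there) (origins ∘ there)) disjoint
  where
  disjoint : ∀ {y} → ¬ (y ∈ f x × y ∈ concatMap f xs)
  disjoint {y} (y∈ , y∈′) with x′ , x′∈ , y∈ₓ′ ← find (∈P.∈-concatMap⁻ f {xs = xs} y∈′) =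
    All.lookup x∉xs x′∈ (trans (sym (origins (here refl) y∈)) (origins (there x′∈) y∈ₓ′))

Unique-blocks : ∀ v k → Unique (blocks v k)
Unique-blocks v zero    = [] ∷ []
Unique-blocks v (suc k) = ((λ ()) ∷ []) ∷ [] ∷ []

Unique-blocksOfSize : ∀ v j → Unique (blocksOfSize v j)
Unique-blocksOfSize v j = Unique-concatUpTo j _ length
  (λ k _ → Unique-if (k ℕ.* v ≡ᵇ j) (blocks v k) (Unique-blocks v k))
  (λ k _ b∈ → blocks-length v k (proj₂ (∈-if⁻ (k ℕ.* v ≡ᵇ j) (blocks v k) b∈)))

leadingBlock : ℕ → List Part → List Part × List Part
leadingBlock v = span (λ q → proj₁ q ℕP.≟ v)

leadingBlock-++ : ∀ N b π → PartsAre (_≡ suc N) b → PartsAre (_≤ N) π → leadingBlock (suc N) (b ++ π) ≡ (b , π)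
leadingBlock-++ N []            []            []         []        = refl
leadingBlock-++ N []            ((w , o) ∷ π) []         (w≤N ∷ _)
  rewrite dec-false (w ℕP.≟ suc N) (ℕP.<⇒≢ (s≤s w≤N)) = refl
leadingBlock-++ N ((w , o) ∷ b) π             (refl ∷ b≡) π≤
  rewrite dec-true (suc N ℕP.≟ suc N) refl | leadingBlock-++ N b π b≡ π≤ = refl

Unique-overpartitionsUpTo : ∀ N n → Unique (overpartitionsUpTo N n)
Unique-overpartitionsUpTo zero    zero    = [] ∷ []
Unique-overpartitionsUpTo zero    (suc n) = []
Unique-overpartitionsUpTo (suc N) n = Unique-concatUpTo n withRest restSize (λ i _ → unique i) labelled
  where
  withRest : ℕ → List (List Part)
  withRest i = concatMap (λ b → map (b ++_) (overpartitionsUpTo N i)) (blocksOfSize (suc N) (n ∸ i))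
  restSize : List Part → ℕ
  restSize = size ∘ proj₂ ∘ leadingBlock (suc N)
  splits : ∀ {i b π} → b ∈ blocksOfSize (suc N) (n ∸ i) → π ∈ overpartitionsUpTo N i →
           leadingBlock (suc N) (b ++ π) ≡ (b , π)
  splits {i} b∈ π∈ = leadingBlock-++ N _ _ (All.lookup (blocksOfSize-parts (suc N) (n ∸ i)) b∈)
                                            (All.lookup (overpartitionsUpTo-parts N i) π∈)
  unique : ∀ i → Unique (withRest i)
  unique i = Unique-concatMap _ (blocksOfSize (suc N) (n ∸ i)) (proj₁ ∘ leadingBlock (suc N))
    (Unique-blocksOfSize (suc N) (n ∸ i))
    (λ {b} _ → UniqueP.map⁺ (ListP.++-cancelˡ b _ _) (Unique-overpartitionsUpTo N i))
    (λ {b} b∈ bπ∈ → let π , π∈ , bπ≡ = ∈P.∈-map⁻ (b ++_) bπ∈ in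
                    trans (cong (proj₁ ∘ leadingBlock (suc N)) bπ≡) (cong proj₁ (splits b∈ π∈)))
  labelled : ∀ i {x} → i ≤ n → x ∈ withRest i → restSize x ≡ i
  labelled i _ x∈
    with b , b∈ , x∈map ← find (∈P.∈-concatMap⁻ _ {xs = blocksOfSize (suc N) (n ∸ i)} x∈)
    with π , π∈ , refl ← ∈P.∈-map⁻ (b ++_) x∈map =
    trans (cong (size ∘ proj₂) (splits b∈ π∈)) (proj₂ (overpartitionsUpTo-sound N i π∈))

-- Counting by the smallest free candidate

module _ (t A′ a′ : ℕ) where

  private
    r A a : ℕ
    r = 2 ℕ.+ t
    A = suc A′
    a = suc a′
    cand : ℕ → ℕ
    cand = candidate A a

  nonfreeBelow≡markedNonfree : ∀ k N → (∀ i → i < k → cand i ≤ N) → ∀ π →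
                               nonfreeBelow t A′ a′ k π ≡ markedNonfree t (candidatesBelow A a k) N π
  nonfreeBelow≡markedNonfree zero    N _     π = sym (markedNonfree-none t N π)
  nonfreeBelow≡markedNonfree (suc k) N below π = begin
    nonfreeBelow t A′ a′ k π ∧ not (free r (cand k) π)
      ≡⟨ cong (_∧ not (free r (cand k) π))
              (nonfreeBelow≡markedNonfree k N (λ i i<k → below i (ℕP.m≤n⇒m≤1+n i<k)) π) ⟩
    markedNonfree t (candidatesBelow A a k) N π ∧ not (free r (cand k) π)
      ≡⟨ markedNonfree-mark t (candidatesBelow A a k) (cand k) N π
                            (candidate-notBelow A′ a′ k) (s≤s z≤n) (below k ℕP.≤-refl) ⟨
    markedNonfree t (candidatesBelow A a (suc k)) N π
      ∎
    where open ≡-Reasoning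

  candidate? : ∀ m → (Σ ℕ λ k → k ℕ.* A ℕ.+ a ≡ m) ⊎ (∀ k → k ℕ.* A ℕ.+ a ≢ m)
  candidate? m with a ℕP.≤? m
  ... | no  a≰m = inj₂ (λ k kA+a≡m → a≰m (subst (a ≤_) kA+a≡m (ℕP.m≤n+m a (k ℕ.* A))))
  ... | yes a≤m with A ∣? (m ∸ a)
  ...   | yes (divides k m-a≡kA) = inj₁ (k , trans (cong (ℕ._+ a) (sym m-a≡kA)) (ℕP.m∸n+n≡m a≤m))
  ...   | no  A∤m-a = inj₂ λ k kA+a≡m →
    A∤m-a (divides k (trans (cong (_∸ a) (sym kA+a≡m)) (ℕP.m+n∸n≡m (k ℕ.* A) a)))

  countᵇ-mes : ∀ m n →
    + countᵇ (λ π → mes r A a π ≡ᵇ m) (overpartitionsUpTo (n ℕ.+ m) n) ≡ rhsCoeff r A a m n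
  countᵇ-mes m n with candidate? m
  ... | inj₂ ≢m = begin
    + countᵇ (λ π → mes r A a π ≡ᵇ m) L   ≡⟨ cong +_ (countᵇ-cong L (All.universal (λ π →
                                                  mes≢nonCandidate t A′ a′ π m ≢m) L)) ⟩
    + countᵇ (λ _ → false) L             ≡⟨ cong +_ (countᵇ-false L) ⟩
    + 0                                  ≡⟨ rhsCoeff-nonCandidate r A′ a′ m n ≢m ⟨
    rhsCoeff r A a m n                   ∎
    where
    open ≡-Reasoning
    L : List (List Part)
    L = overpartitionsUpTo (n ℕ.+ m) n
  ... | inj₁ (k , refl) = begin
    + countᵇ (λ π → mes r A a π ≡ᵇ (k ℕ.* A ℕ.+ a)) L
      ≡⟨ cong +_ (countᵇ-cong L (All.universal (λ π → mes≡candidate t A′ a′ π k) L)) ⟩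
    + countᵇ (λ π → below k π ∧ free r (cand k) π) L
      ≡⟨ m+n≡o⇒+m≡+o-+n _ _ _ (countᵇ-∧-split (below k) (free r (cand k)) L) ⟩
    + countᵇ (below k) L ℤ.- + countᵇ (below (suc k)) L
      ≡⟨ cong₂ ℤ._-_ (restricted k (ℕP.n≤1+n k)) (restricted (suc k) ℕP.≤-refl) ⟩
    restrictedGF t (candidatesBelow A a k) N n ℤ.- restrictedGF t (candidatesBelow A a (suc k)) N n
      ≡⟨ rhsCoeff-restrictedGF r A′ a′ k n N (ℕP.m≤m+n n _) candidate≤N ⟨
    rhsCoeff r A a (k ℕ.* A ℕ.+ a) n
      ∎
    where
    open ≡-Reasoning
    N : ℕ
    N = n ℕ.+ (k ℕ.* A ℕ.+ a)
    L : List (List Part)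
    L = overpartitionsUpTo N n
    below : ℕ → List Part → Bool
    below j = nonfreeBelow t A′ a′ j
    candidate≤N : cand k ≤ N
    candidate≤N = subst (_≤ N) (ℕP.+-comm (k ℕ.* A) a) (ℕP.m≤n+m (k ℕ.* A ℕ.+ a) n)
    restricted : ∀ j → j ≤ suc k → + countᵇ (below j) L ≡ restrictedGF t (candidatesBelow A a j) N n
    restricted j j≤1+k = trans
      (cong +_ (countᵇ-cong L (All.universal (nonfreeBelow≡markedNonfree j N λ i i<j →
        ℕP.≤-trans (candidate-mono-≤ A′ a′ (ℕP.≤-pred (ℕP.≤-trans i<j j≤1+k))) candidate≤N) L)))
      (countᵇ-markedNonfree t (candidatesBelow A a j) N n)

length-filterᵇ : ∀ {X : Set} (p : X → Bool) xs → length (filterᵇ p xs) ≡ countᵇ p xs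
length-filterᵇ p []       = refl
length-filterᵇ p (x ∷ xs) with p x
... | true  = cong suc (length-filterᵇ p xs)
... | false = length-filterᵇ p xs

index-lookup : ∀ {X : Set} (L : List X) → Unique L → ∀ {x} (x∈ : x ∈ L) i → lookup L i ≡ x → index x∈ ≡ i
index-lookup (y ∷ ys) unique           (here refl) Fin.zero    _       = refl
index-lookup (y ∷ ys) (y∉ys ∷ unique) (here refl) (Fin.suc i) lookup≡ =
  ⊥-elim (All.lookup y∉ys (subst (_∈ ys) lookup≡ (∈P.∈-lookup i)) refl)
index-lookup (y ∷ ys) (y∉ys ∷ unique) (there x∈)  Fin.zero    refl    = ⊥-elim (All.lookup y∉ys x∈ refl)
index-lookup (y ∷ ys) (y∉ys ∷ unique) (there x∈)  (Fin.suc i) lookup≡ =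
  cong Fin.suc (index-lookup ys unique x∈ i lookup≡)

enumeration↔ : ∀ {X : Set} (P : X → Bool) (L : List X) → Unique L → (∀ {x} → x ∈ L → T (P x)) →
               (∀ {x} → T (P x) → x ∈ L) → (Σ X λ x → T (P x)) ↔ Fin (length L)
enumeration↔ {X} P L unique sound complete = mk↔ₛ′ to from to∘from from∘to
  where
  to : (Σ X λ x → T (P x)) → Fin (length L)
  to (x , Px) = index (complete Px)
  from : Fin (length L) → Σ X λ x → T (P x)
  from i = lookup L i , sound (∈P.∈-lookup i)
  to∘from : ∀ i → to (from i) ≡ i
  to∘from i = index-lookup L unique (complete (sound (∈P.∈-lookup i))) i refl
  from∘to : ∀ y → from (to y) ≡ y
  from∘to (x , Px) = Σ-≡ (sym (lookup-index (complete Px))) _ Px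
    where
    Σ-≡ : ∀ {x′} → x′ ≡ x → (Px′ : T (P x′)) (Px : T (P x)) →
          _≡_ {A = Σ X λ x → T (P x)} (x′ , Px′) (x , Px)
    Σ-≡ refl Px′ Px = cong (x ,_) (BoolP.T-irrelevant Px′ Px)

parts-≤-size : ∀ π → PartsAre (_≤ size π) π
parts-≤-size []            = []
parts-≤-size ((v , o) ∷ π) =
  ℕP.m≤m+n v (size π) ∷ All.map (λ u≤ → ℕP.≤-trans u≤ (ℕP.m≤n+m (size π) v)) (parts-≤-size π)

module _ (t A′ a′ : ℕ) (m n : ℕ) where

  private
    r A a N : ℕ
    r = 2 ℕ.+ t
    A = suc A′
    a = suc a′
    N = n ℕ.+ m
    mes≡m : List Part → Bool
    mes≡m π = mes r A a π ≡ᵇ m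

  overpartitionsWith↔ : OverpartitionsWith r A a n m ↔ Fin (length (filterᵇ mes≡m (overpartitionsUpTo N n)))
  overpartitionsWith↔ = enumeration↔ _ (filterᵇ mes≡m (overpartitionsUpTo N n))
    (UniqueP.filter⁺ _ (Unique-overpartitionsUpTo N n)) sound complete
    where
    sound : ∀ {π} → π ∈ filterᵇ mes≡m (overpartitionsUpTo N n) →
            T (isOverpartition π ∧ ((size π ≡ᵇ n) ∧ mes≡m π))
    sound {π} π∈ with π∈E , mes≡ ← ∈P.∈-filter⁻ _ π∈
                 with isOP , size≡n ← overpartitionsUpTo-sound N n π∈E =
      T-∧⁺ (isOverpartition π) isOP (T-∧⁺ (size π ≡ᵇ n) (ℕP.≡⇒≡ᵇ (size π) n size≡n) mes≡)
    complete : ∀ {π} → T (isOverpartition π ∧ ((size π ≡ᵇ n) ∧ mes≡m π)) →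
               π ∈ filterᵇ mes≡m (overpartitionsUpTo N n)
    complete {π} with-props with isOP , rest ← T-∧⁻ (isOverpartition π) with-props
                            with size≡ᵇn , mes≡ ← T-∧⁻ (size π ≡ᵇ n) rest =
      ∈P.∈-filter⁺ _ (subst (λ j → π ∈ overpartitionsUpTo N j) size≡n
        (overpartitionsUpTo-complete N π isOP (All.map (λ v≤ → ℕP.≤-trans v≤ size≤N) (parts-≤-size π)))) mes≡
      where
      size≡n : size π ≡ n
      size≡n = ℕP.≡ᵇ⇒≡ (size π) n size≡ᵇn
      size≤N : size π ≤ N
      size≤N = subst (_≤ N) (sym size≡n) (ℕP.m≤m+n n m)

theorem2p8 : (A a r : ℕ) → 1 ≤ a → a ≤ A → 2 ≤ r → (m n : ℕ) →
    ∃[ c ] ((+ c ≡ rhsCoeff r A a m n) × (OverpartitionsWith r A a n m ↔ Fin c))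
theorem2p8 (suc A′) (suc a′) (suc (suc t)) (s≤s z≤n) (s≤s _) (s≤s (s≤s _)) m n =
  length (filterᵇ mes≡m L) ,
  trans (cong +_ (length-filterᵇ mes≡m L)) (countᵇ-mes t A′ a′ m n) ,
  overpartitionsWith↔ t A′ a′ m n
  where
  L : List (List Part)
  L = overpartitionsUpTo (n ℕ.+ m) n
  mes≡m : List Part → Bool
  mes≡m π = mes (suc (suc t)) (suc A′) (suc a′) π ≡ᵇ m
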